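{- Let $n\ge0$. The map $\theta$ defined in the context is a well-defined bijection from the set of compatible pairs on the maximal Dyck path $\mathcal{D}^{(n+1)\times n}$ onto the set of nondecreasing Dyck paths of length $2n+4$.
   Context: $\mathcal{D}=\mathcal{D}^{(n+1)\times n}$ is the lattice path from $(0,0)$ to $(n+1,n)$ with vertices $A_0=(0,0)$, $A_1=B_0=(1,0)$, and for $1\le i\le n$, $B_i=(i+1,i-1)$, $A_{i+1}=(i+1,i)$. Horizontal edges: $u_i=A_iB_i$ ($0\le i\le n$), $\mathcal{D}_1=\{u_0,\dots,u_n\}$; vertical edges $v_j=B_jA_{j+1}$ ($1\le j\le n$), $\mathcal{D}_2=\{v_1,\dots,v_n\}$. Identify $(n+1,n)$ with $(0,0)$. For lattice points $P,Q$ on $\mathcal{D}$, the subpath $PQ$ is the part of $\mathcal{D}$ from $P$ going northeast until $Q$, looping from $(n+1,n)$ to $(0,0)$ if needed (if $P=Q$, the full loop); $(PQ)_1,(PQ)_2$ are its horizontal/vertical edges and $(PQ)^\circ$ its lattice points other than $P,Q$. A pair $(S_1,S_2)$, $S_1\subseteq\mathcal{D}_1$, $S_2\subseteq\mathcal{D}_2$, is compatible if for all $u\in S_1$, $v\in S_2$, with $E$ the left endpoint of $u$ and $F$ the upper endpoint of $v$, there exists $A\in(EF)^\circ$ with $|(AF)_1|=2|(AF)_2\cap S_2|$ or $|(EA)_2|=2|(EA)_1\cap S_1|$. A Dyck path of length $2N$ is a sequence of $2N$ steps $(1,1)$ (up) or $(1,-1)$ (down) from $(0,0)$ to $(2N,0)$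 staying in $\{y\ge0\}$. A valley is a point where a down step is followed by an up step; the path is nondecreasing if the altitudes of its valleys, left to right, are nondecreasing. Cutting at the valleys splits the path into consecutive mountains; the magnitude of a mountain is $(d,e)$, its numbers of up and down steps. The map $\theta$: to $(S_1,S_2)$ associate the word $\ell_0\cdots\ell_n$ with $\ell_0=U$ if $u_0\in S_1$, else $\ell_0=O$; and for $1\le i\le n$: $\ell_i=O$ if $u_i\notin S_1,v_i\notin S_2$; $\ell_i=U$ if $u_i\in S_1,v_i\notin S_2$; $\ell_i=V$ if $u_i\notin S_1,v_i\in S_2$. Split the word into consecutive blocks $U^{a_i}OV^{b_i}$ ($1\le i\le k$, $a_i,b_i\ge0$, $k$ the number of $O$'s) followed by a final (possibly empty) block $U^c$. Then $\theta(S_1,S_2)$ is the Dyck path consisting of consecutive mountains of magnitudes $(a_i+b_i+1,a_i+1)$, $1\le i\le k$, followed by a last mountain of magnitude $\big(n+2-\sum_{i=1}^k(a_i+b_i+1),\,n+2-\sum_{i=1}^k(a_i+1)\big)$. -}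

module Defs where

open import Data.Nat using (ℕ; zero; suc; _+_; _*_; _∸_; _<_; _≤_; _≡ᵇ_)
open import Data.Nat.DivMod using (_%_)
open import Data.Bool using (Bool; true; false; if_then_else_)
open import Data.Fin using (Fin; zero; suc; toℕ)
open import Data.Fin.Subset using (Subset; _∈_)
open import Data.Vec using (lookup)
open import Data.List using (List; []; _∷_; _++_; length; take; drop; concatMap; allFin; replicate; map)
open import Data.Maybe using (Maybe; just; nothing)
open import Data.Product using (_×_; _,_; ∃-syntax)
open import Data.Sum using (_⊎_)
open import Data.List.Relation.Unary.Linked using (Linked)
open import Relation.Binary.PropositionalEquality using (_≡_)

-- Traversed from (0,0) northeast, the edges are
--   u_0, u_1, v_1, u_2, v_2, …, u_n, v_n      (2n+1 edges)
-- and, after identifying (n+1,n) with (0,0), the lattice points are the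
-- 2n+1 points at positions 0,…,2n; the edge at position e joins the point
-- at position e to the point at position e+1 (mod 2n+1).

data Edge (n : ℕ) : Set where
  hor : Fin (suc n) → Edge n   -- hor i     = u_i       (0 ≤ i ≤ n)
  ver : Fin n → Edge n         -- ver j     = v_{j+1}   (0 ≤ j < n)

edges : (n : ℕ) → List (Edge n)
edges n = hor zero ∷ concatMap (λ j → hor (suc j) ∷ ver j ∷ []) (allFin n)

-- position of the left endpoint E = A_i of u_i
posU : {n : ℕ} → Fin (suc n) → ℕ
posU zero    = 0
posU (suc j) = 1 + 2 * toℕ j

-- position of the upper endpoint F = A_{j+2} of v_{j+1} (A_{n+1} ≡ A_0)
posF : (n : ℕ) → Fin n → ℕ
posF n j = (3 + 2 * toℕ j) % suc (2 * n)

-- number of edges of the subpath PQ (full loop if P = Q)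
subLen : ℕ → ℕ → ℕ → ℕ
subLen n p q = if p ≡ᵇ q then suc (2 * n) else ((q + suc (2 * n)) ∸ p) % suc (2 * n)

-- edges of the subpath PQ, in order (for positions p, q ≤ 2n)
subpath : (n : ℕ) → ℕ → ℕ → List (Edge n)
subpath n p q = take (subLen n p q) (drop p (edges n ++ edges n))

count : {A : Set} → (A → Bool) → List A → ℕ
count f []       = 0
count f (x ∷ xs) = if f x then suc (count f xs) else count f xs

isH : {n : ℕ} → Edge n → Bool
isH (hor _) = true
isH (ver _) = false

isV : {n : ℕ} → Edge n → Bool
isV (hor _) = false
isV (ver _) = true

inS1 : {n : ℕ} → Subset (suc n) → Edge n → Bool
inS1 S1 (hor i) = lookup S1 i
inS1 S1 (ver _) = false

inS2 : {n : ℕ} → Subset n → Edge n → Bool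
inS2 S2 (hor _) = false
inS2 S2 (ver j) = lookup S2 j

-- S1 ⊆ D1 = {u_0,…,u_n} as a Subset (suc n) (index i ↦ u_i);
-- S2 ⊆ D2 = {v_1,…,v_n} as a Subset n     (index j ↦ v_{j+1}).
-- A lattice point A ∈ (EF)° is the point after the first t edges of EF,
-- with 0 < t < |EF|; then EA = first t edges, AF = remaining edges.
Compatible : (n : ℕ) → Subset (suc n) → Subset n → Set
Compatible n S1 S2 =
  (i : Fin (suc n)) (j : Fin n) → i ∈ S1 → j ∈ S2 →
  let P = subpath n (posU i) (posF n j) in
  ∃[ t ] (0 < t × t < length P ×
          (count isH (drop t P) ≡ 2 * count (inS2 S2) (drop t P)
           ⊎ count isV (take t P) ≡ 2 * count (inS1 S1) (take t P)))

data Step : Set where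
  up down : Step

data DyckFrom : ℕ → List Step → Set where
  done  : DyckFrom 0 []
  stepU : {h : ℕ} {w : List Step} → DyckFrom (suc h) w → DyckFrom h (up ∷ w)
  stepD : {h : ℕ} {w : List Step} → DyckFrom h w → DyckFrom (suc h) (down ∷ w)

IsDyck : List Step → Set
IsDyck w = DyckFrom 0 w

valleysFrom : ℕ → List Step → List ℕ
valleysFrom h []                 = []
valleysFrom h (up ∷ w)           = valleysFrom (suc h) w
valleysFrom h (down ∷ up ∷ w)    = (h ∸ 1) ∷ valleysFrom (h ∸ 1) (up ∷ w)
valleysFrom h (down ∷ down ∷ w)  = valleysFrom (h ∸ 1) (down ∷ w)
valleysFrom h (down ∷ [])        = []

valleys : List Step → List ℕ
valleys = valleysFrom 0

NondecDyck : ℕ → List Step → Set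
NondecDyck N w = length w ≡ 2 * N × IsDyck w × Linked _≤_ (valleys w)

data Letter : Set where
  O U V : Letter

-- the word ℓ_0 ⋯ ℓ_n (undefined if u_i ∈ S1 and v_i ∈ S2 for some i)
letter0 : Bool → Letter
letter0 true  = U
letter0 false = O

letterUV : Bool → Bool → Maybe Letter
letterUV false false = just O
letterUV true  false = just U
letterUV false true  = just V
letterUV true  true  = nothing

consM : {A : Set} → Maybe A → Maybe (List A) → Maybe (List A)
consM (just x) (just xs) = just (x ∷ xs)
consM _        _         = nothing

wordTail : {n : ℕ} → Subset (suc n) → Subset n → List (Fin n) → Maybe (List Letter)
wordTail S1 S2 []       = just []
wordTail S1 S2 (j ∷ js) = consM (letterUV (lookup S1 (suc j)) (lookup S2 j)) (wordTail S1 S2 js)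

word : (n : ℕ) → Subset (suc n) → Subset n → Maybe (List Letter)
word n S1 S2 = consM (just (letter0 (lookup S1 zero))) (wordTail S1 S2 (allFin n))

-- Parsing a word as U^{a_1} O V^{b_1} ⋯ U^{a_k} O V^{b_k} U^c.
-- pv w = (v , blocks , c) where v is the number of leading V's of w
-- (to be attached to a preceding O) and the rest of w factors as
-- blocks (a_i , b_i) followed by U^c; nothing if no such factorisation.
pv : List Letter → Maybe (ℕ × List (ℕ × ℕ) × ℕ)
pv [] = just (0 , [] , 0)
pv (V ∷ w) with pv w
... | just (v , bs , c) = just (suc v , bs , c)
... | nothing = nothing
pv (O ∷ w) with pv w
... | just (v , bs , c) = just (0 , (0 , v) ∷ bs , c)
... | nothing = nothing
pv (U ∷ w) with pv w
... | just (0 , [] , c) = just (0 , [] , suc c)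
... | just (0 , (a , b) ∷ bs , c) = just (0 , (suc a , b) ∷ bs , c)
... | just (suc _ , _ , _) = nothing
... | nothing = nothing

parse : List Letter → Maybe (List (ℕ × ℕ) × ℕ)
parse w with pv w
... | just (0 , bs , c) = just (bs , c)
... | just (suc _ , _ , _) = nothing
... | nothing = nothing

mountain : ℕ × ℕ → List Step
mountain (d , e) = replicate d up ++ replicate e down

sumN : List ℕ → ℕ
sumN []       = 0
sumN (x ∷ xs) = x + sumN xs

pathOfBlocks : ℕ → List (ℕ × ℕ) → List Step
pathOfBlocks n bs =
  concatMap (λ { (a , b) → mountain (a + b + 1 , a + 1) }) bs
  ++ mountain ( n + 2 ∸ sumN (map (λ { (a , b) → a + b + 1 }) bs)
              , n + 2 ∸ sumN (map (λ { (a , _) → a + 1 }) bs))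

θ : (n : ℕ) → Subset (suc n) → Subset n → Maybe (List Step)
θ n S1 S2 with word n S1 S2
... | nothing = nothing
... | just w with parse w
...   | nothing = nothing
...   | just (bs , _) = just (pathOfBlocks n bs)

-- Compatibility means separation: whenever v_{j+1} ∈ S2, neither u_j nor
-- u_{j+1} lies in S1. The subpaths from u_j or u_{j+1} to v_{j+1} are too short
-- for either balance equation to hold at an interior point, which gives
-- necessity. Conversely, cut the subpath EF into chunks u_i v_i: a run of
-- chunks starting at u ∈ S1 cannot reach v ∈ S2 without an unmarked chunk, so
-- fewer edges are marked than there are chunks. Hence one of the two balances
-- is won by the counting side at one end of EF while u ∈ S1 and v ∈ S2 make the
-- marked side win at the other; the counts change by at most one per step, so
-- they agree at some interior point A.
--
-- For separated pairs the word ℓ is defined, does not start with V and has no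
-- factor UV; these are exactly the words U^{a_1} O V^{b_1} ⋯ U^{a_k} O V^{b_k} U^c,
-- each parsed in exactly one way, and (S1, S2) is recovered from ℓ letter by
-- letter. Finally the mountains (a_i + b_i + 1, a_i + 1) end in valleys rising by
-- b_i, and peeling off first mountains inverts the construction on nondecreasing
-- Dyck paths.

module Submission where

open import Defs
open import Data.Nat using (ℕ; zero; suc; _+_; _*_; _∸_; _⊓_; _≤_; _≰_; _≥_; _<_; _≤?_; _<?_; _≡ᵇ_; z≤n; s≤s)
open import Data.Nat.Properties
open import Data.Nat.DivMod using (_%_; [m+n]%n≡m%n; m<n⇒m%n≡m; n%n≡0; m%n<n)
open import Data.Nat.Tactic.RingSolver using (solve-∀)
open import Data.Bool using (Bool; true; false; T)
open import Data.Fin using (Fin; zero; suc; toℕ; inject₁)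
open import Data.Fin.Properties using (toℕ<n; toℕ-inject₁; toℕ-injective)
open import Data.Fin.Subset using (Subset)
open import Data.Vec using (Vec; []; _∷_; lookup)
open import Data.Vec.Properties using ([]=⇒lookup; lookup⇒[]=)
open import Data.List using (List; []; _∷_; _++_; length; take; drop; concatMap; allFin; map; tabulate; replicate; head; last)
open import Data.List.Properties using (length-++; length-++-≤ʳ; length-drop; length-take; length-tabulate; length-replicate; ++-identityʳ; ++-assoc; ∷-injective; take-drop; take-take; take++drop≡id; take-all; take-suc-tabulate; take-map; concatMap-++; map-tabulate)
open import Data.List.Relation.Unary.Linked as Linked using (Linked; []; [-]; _∷_)
open import Data.List.Relation.Unary.Linked.Properties using (++⁺)
open import Data.Maybe using (just; nothing)
open import Data.Maybe.Properties using (just-injective)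
open import Data.Maybe.Relation.Binary.Connected using (Connected; just; nothing; just-nothing; nothing-just)
open import Data.Product using (∃-syntax; _×_; _,_; proj₁; proj₂)
open import Data.Sum using (_⊎_; inj₁; inj₂)
open import Data.Unit using (⊤; tt)
open import Data.Empty using (⊥)
open import Relation.Nullary using (¬_; Dec; yes; no; contradiction)
open import Relation.Binary.PropositionalEquality

-- Slicing and counting in lists

module _ {A : Set} where

  take-++-length : ∀ (xs : List A) m ys → take (length xs + m) (xs ++ ys) ≡ xs ++ take m ys
  take-++-length []       m ys = refl
  take-++-length (x ∷ xs) m ys = cong (x ∷_) (take-++-length xs m ys)

  drop-++-length : ∀ (xs : List A) m ys → drop (length xs + m) (xs ++ ys) ≡ drop m ys
  drop-++-length []       m ys = refl
  drop-++-length (x ∷ xs) m ys = drop-++-length xs m ys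

  take-length-++ : ∀ (xs ys : List A) → take (length xs) (xs ++ ys) ≡ xs
  take-length-++ []       ys = refl
  take-length-++ (x ∷ xs) ys = cong (x ∷_) (take-length-++ xs ys)

  drop-length-++ : ∀ (xs ys : List A) → drop (length xs) (xs ++ ys) ≡ ys
  drop-length-++ []       ys = refl
  drop-length-++ (x ∷ xs) ys = drop-length-++ xs ys

  take-++-≤ : ∀ m (xs ys : List A) → m ≤ length xs → take m (xs ++ ys) ≡ take m xs
  take-++-≤ zero    xs       ys _         = refl
  take-++-≤ (suc m) (x ∷ xs) ys (s≤s m≤) = cong (x ∷_) (take-++-≤ m xs ys m≤)

  drop-++-≤ : ∀ m (xs ys : List A) → m ≤ length xs → drop m (xs ++ ys) ≡ drop m xs ++ ys
  drop-++-≤ zero    xs       ys _         = refl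
  drop-++-≤ (suc m) (x ∷ xs) ys (s≤s m≤) = drop-++-≤ m xs ys m≤

  last-∷ʳ : ∀ (xs : List A) x → last (xs ++ x ∷ []) ≡ just x
  last-∷ʳ []           x = refl
  last-∷ʳ (y ∷ [])     x = refl
  last-∷ʳ (y ∷ z ∷ xs) x = last-∷ʳ (z ∷ xs) x

  -- The cyclic interval [a, b) of xs; all of xs, rotated, when a = b.
  cyclicSlice : ℕ → ℕ → List A → List A
  cyclicSlice a b xs with a <? b
  ... | yes _ = drop a (take b xs)
  ... | no  _ = drop a xs ++ take b xs

  cyclicSlice-< : ∀ {a b} (xs : List A) → a < b → cyclicSlice a b xs ≡ drop a (take b xs)
  cyclicSlice-< {a} {b} xs a<b with a <? b
  ... | yes _   = refl
  ... | no  a≮b = contradiction a<b a≮b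

  cyclicSlice-≥ : ∀ {a b} (xs : List A) → b ≤ a → cyclicSlice a b xs ≡ drop a xs ++ take b xs
  cyclicSlice-≥ {a} {b} xs b≤a with a <? b
  ... | yes a<b = contradiction b≤a (<⇒≱ a<b)
  ... | no  _   = refl

module _ {A : Set} (f : A → Bool) where

  count-++ : ∀ xs ys → count f (xs ++ ys) ≡ count f xs + count f ys
  count-++ []       ys = refl
  count-++ (x ∷ xs) ys with f x
  ... | true  = cong suc (count-++ xs ys)
  ... | false = count-++ xs ys

  count-∷-true : ∀ {x} xs → f x ≡ true → count f (x ∷ xs) ≡ suc (count f xs)
  count-∷-true xs fx rewrite fx = refl

  count-drop-≤ : ∀ t (xs : List A) → count f (drop t xs) ≤ count f xs
  count-drop-≤ zero    xs       = ≤-refl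
  count-drop-≤ (suc t) []       = z≤n
  count-drop-≤ (suc t) (x ∷ xs) with f x
  ... | true  = m≤n⇒m≤1+n (count-drop-≤ t xs)
  ... | false = count-drop-≤ t xs

  count-take-≤ : ∀ {s t} (xs : List A) → s ≤ t → count f (take s xs) ≤ count f (take t xs)
  count-take-≤ xs       z≤n       = z≤n
  count-take-≤ []       (s≤s s≤t) = z≤n
  count-take-≤ (x ∷ xs) (s≤s s≤t) with f x
  ... | true  = s≤s (count-take-≤ xs s≤t)
  ... | false = count-take-≤ xs s≤t

  count-take+drop : ∀ t (xs : List A) → count f (take t xs) + count f (drop t xs) ≡ count f xs
  count-take+drop t xs = trans (sym (count-++ (take t xs) (drop t xs))) (cong (count f) (take++drop≡id t xs))

  count-take-≤-all : ∀ t (xs : List A) → count f (take t xs) ≤ count f xs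
  count-take-≤-all t xs = subst (count f (take t xs) ≤_) (count-take+drop t xs) (m≤m+n _ _)

  count-cyclicSlice-≤ : ∀ a b (xs : List A) → count f (cyclicSlice a b xs) ≤ count f xs
  count-cyclicSlice-≤ a b xs = by-cases (a <? b)
    where
    by-cases : Dec (a < b) → count f (cyclicSlice a b xs) ≤ count f xs
    by-cases (yes a<b) rewrite cyclicSlice-< xs a<b = begin
      count f (drop a (take b xs))               ≤⟨ count-drop-≤ a (take b xs) ⟩
      count f (take b xs)                        ≤⟨ count-take-≤-all b xs ⟩
      count f xs                                 ∎
      where open ≤-Reasoning
    by-cases (no a≮b) rewrite cyclicSlice-≥ xs (≮⇒≥ a≮b) = begin
      count f (drop a xs ++ take b xs)
        ≡⟨ count-++ (drop a xs) (take b xs) ⟩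
      count f (drop a xs) + count f (take b xs)
        ≤⟨ +-monoʳ-≤ (count f (drop a xs)) (count-take-≤ xs (≮⇒≥ a≮b)) ⟩
      count f (drop a xs) + count f (take a xs)
        ≡⟨ +-comm (count f (drop a xs)) (count f (take a xs)) ⟩
      count f (take a xs) + count f (drop a xs)
        ≡⟨ count-take+drop a xs ⟩
      count f xs                                 ∎
      where open ≤-Reasoning

  count-take-suc-≤ : ∀ t (xs : List A) → count f (take (suc t) xs) ≤ suc (count f (take t xs))
  count-take-suc-≤ t       []       = z≤n
  count-take-suc-≤ zero    (x ∷ xs) with f x
  ... | true  = ≤-refl
  ... | false = z≤n
  count-take-suc-≤ (suc t) (x ∷ xs) with f x
  ... | true  = s≤s (count-take-suc-≤ t xs)
  ... | false = count-take-suc-≤ t xs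

  count-take-mono : ∀ t (xs : List A) → count f (take t xs) ≤ count f (take (suc t) xs)
  count-take-mono t xs = count-take-≤ xs (n≤1+n t)

  count-drop-≤-suc : ∀ t (xs : List A) → count f (drop t xs) ≤ suc (count f (drop (suc t) xs))
  count-drop-≤-suc zero    []       = z≤n
  count-drop-≤-suc (suc t) []       = z≤n
  count-drop-≤-suc zero    (x ∷ xs) with f x
  ... | true  = ≤-refl
  ... | false = n≤1+n _
  count-drop-≤-suc (suc t) (x ∷ xs) = count-drop-≤-suc t xs

  count-drop-antimono : ∀ t (xs : List A) → count f (drop (suc t) xs) ≤ count f (drop t xs)
  count-drop-antimono zero    xs       = count-drop-≤ 1 xs
  count-drop-antimono (suc t) []       = z≤n
  count-drop-antimono (suc t) (x ∷ xs) = count-drop-antimono t xs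

module _ {A : Set} {R : A → A → Set} where

  Linked-take : ∀ t {xs} → Linked R xs → Linked R (take t xs)
  Linked-take zero          _          = []
  Linked-take (suc t)       []         = []
  Linked-take (suc zero)    [-]        = [-]
  Linked-take (suc (suc t)) [-]        = [-]
  Linked-take (suc zero)    (_ ∷ _)    = [-]
  Linked-take (suc (suc t)) (r ∷ rs)   = r ∷ Linked-take (suc t) rs

  Linked-drop : ∀ t {xs} → Linked R xs → Linked R (drop t xs)
  Linked-drop zero          rs         = rs
  Linked-drop (suc t)       []         = []
  Linked-drop (suc zero)    [-]        = []
  Linked-drop (suc (suc t)) [-]        = []
  Linked-drop (suc t)       (_ ∷ rs)   = Linked-drop t rs

drop-tabulate : ∀ {A : Set} {m} (f : Fin m → A) (i : Fin m) →
                drop (toℕ i) (tabulate f) ≡ f i ∷ drop (suc (toℕ i)) (tabulate f)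
drop-tabulate f zero    = refl
drop-tabulate f (suc i) = drop-tabulate (λ k → f (suc k)) i

module _ {A B : Set} (f : A → List B) where

  chunkStart : ℕ → List A → ℕ
  chunkStart k xs = length (concatMap f (take k xs))

  take-chunkStart : ∀ k xs → take (chunkStart k xs) (concatMap f xs) ≡ concatMap f (take k xs)
  take-chunkStart zero    xs       = refl
  take-chunkStart (suc k) []       = refl
  take-chunkStart (suc k) (x ∷ xs) = begin
    take (length (f x ++ concatMap f (take k xs))) (f x ++ concatMap f xs)
      ≡⟨ cong (λ l → take l (f x ++ concatMap f xs)) (length-++ (f x)) ⟩
    take (length (f x) + chunkStart k xs) (f x ++ concatMap f xs)
      ≡⟨ take-++-length (f x) (chunkStart k xs) (concatMap f xs) ⟩
    f x ++ take (chunkStart k xs) (concatMap f xs)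
      ≡⟨ cong (f x ++_) (take-chunkStart k xs) ⟩
    f x ++ concatMap f (take k xs) ∎
    where open ≡-Reasoning

  drop-chunkStart : ∀ k xs → drop (chunkStart k xs) (concatMap f xs) ≡ concatMap f (drop k xs)
  drop-chunkStart zero    xs       = refl
  drop-chunkStart (suc k) []       = refl
  drop-chunkStart (suc k) (x ∷ xs) = begin
    drop (length (f x ++ concatMap f (take k xs))) (f x ++ concatMap f xs)
      ≡⟨ cong (λ l → drop l (f x ++ concatMap f xs)) (length-++ (f x)) ⟩
    drop (length (f x) + chunkStart k xs) (f x ++ concatMap f xs)
      ≡⟨ drop-++-length (f x) (chunkStart k xs) (concatMap f xs) ⟩
    drop (chunkStart k xs) (concatMap f xs)
      ≡⟨ drop-chunkStart k xs ⟩
    concatMap f (drop k xs) ∎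
    where open ≡-Reasoning

  chunkStart-suc : ∀ k x xs → chunkStart (suc k) (x ∷ xs) ≡ length (f x) + chunkStart k xs
  chunkStart-suc k x xs = length-++ (f x)

  chunkStart-mono : ∀ {a b} xs → a ≤ b → chunkStart a xs ≤ chunkStart b xs
  chunkStart-mono         xs       z≤n       = z≤n
  chunkStart-mono         []       (s≤s a≤b) = z≤n
  chunkStart-mono {suc a} {suc b} (x ∷ xs) (s≤s a≤b) =
    subst₂ _≤_ (sym (chunkStart-suc a x xs)) (sym (chunkStart-suc b x xs))
      (+-monoʳ-≤ (length (f x)) (chunkStart-mono xs a≤b))

  chunkStart-strict : (∀ x → 0 < length (f x)) →
                      ∀ {a b} xs → a < b → b ≤ length xs → chunkStart a xs < chunkStart b xs
  chunkStart-strict nonempty {zero}  {suc b} (x ∷ xs) a<b b≤ =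
    subst (0 <_) (sym (chunkStart-suc b x xs)) (≤-trans (nonempty x) (m≤m+n _ _))
  chunkStart-strict nonempty {suc a} {suc b} (x ∷ xs) (s≤s a<b) (s≤s b≤) =
    subst₂ _<_ (sym (chunkStart-suc a x xs)) (sym (chunkStart-suc b x xs))
      (+-monoʳ-< (length (f x)) (chunkStart-strict nonempty xs a<b b≤))

  concatMap-cyclicSlice : (∀ x → 0 < length (f x)) → ∀ a b xs → b ≤ length xs →
    cyclicSlice (chunkStart a xs) (chunkStart b xs) (concatMap f xs) ≡ concatMap f (cyclicSlice a b xs)
  concatMap-cyclicSlice nonempty a b xs b≤ = by-cases (a <? b)
    where
    open ≡-Reasoning
    by-cases : Dec (a < b) →
      cyclicSlice (chunkStart a xs) (chunkStart b xs) (concatMap f xs) ≡ concatMap f (cyclicSlice a b xs)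
    by-cases (yes a<b) = begin
      cyclicSlice (chunkStart a xs) (chunkStart b xs) (concatMap f xs)
        ≡⟨ cyclicSlice-< (concatMap f xs) (chunkStart-strict nonempty xs a<b b≤) ⟩
      drop (chunkStart a xs) (take (chunkStart b xs) (concatMap f xs))
        ≡⟨ cong (drop (chunkStart a xs)) (take-chunkStart b xs) ⟩
      drop (chunkStart a xs) (concatMap f (take b xs))
        ≡⟨ cong (λ ys → drop (length (concatMap f ys)) (concatMap f (take b xs))) take-a ⟩
      drop (chunkStart a (take b xs)) (concatMap f (take b xs))
        ≡⟨ drop-chunkStart a (take b xs) ⟩
      concatMap f (drop a (take b xs))
        ≡⟨ cong (concatMap f) (sym (cyclicSlice-< xs a<b)) ⟩
      concatMap f (cyclicSlice a b xs) ∎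
      where
      take-a : take a xs ≡ take a (take b xs)
      take-a = sym (trans (take-take a b xs) (cong (λ k → take k xs) (m≤n⇒m⊓n≡m (<⇒≤ a<b))))
    by-cases (no a≮b) = begin
      cyclicSlice (chunkStart a xs) (chunkStart b xs) (concatMap f xs)
        ≡⟨ cyclicSlice-≥ (concatMap f xs) (chunkStart-mono xs (≮⇒≥ a≮b)) ⟩
      drop (chunkStart a xs) (concatMap f xs) ++ take (chunkStart b xs) (concatMap f xs)
        ≡⟨ cong₂ _++_ (drop-chunkStart a xs) (take-chunkStart b xs) ⟩
      concatMap f (drop a xs) ++ concatMap f (take b xs)
        ≡⟨ sym (concatMap-++ f (drop a xs) (take b xs)) ⟩
      concatMap f (drop a xs ++ take b xs)
        ≡⟨ cong (concatMap f) (sym (cyclicSlice-≥ xs (≮⇒≥ a≮b))) ⟩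
      concatMap f (cyclicSlice a b xs) ∎

-- Discrete intermediate value theorems: a function moving up (down) by at
-- most one per step meets a monotone function it crosses.

crossing-upward : (f g : ℕ → ℕ) → (∀ t → f (suc t) ≤ suc (f t)) → (∀ t → g t ≤ g (suc t)) →
                  ∀ t₀ t₁ → t₀ ≤ t₁ → f t₀ < g t₀ → g t₁ ≤ f t₁ →
                  ∃[ t ] (t₀ < t × t ≤ t₁ × f t ≡ g t)
crossing-upward f g f-step g-mono t₀ zero    z≤n f<g g≤f = contradiction g≤f (<⇒≱ f<g)
crossing-upward f g f-step g-mono t₀ (suc t) t₀≤ f<g g≤f with t₀ ≟ suc t | g t ≤? f t
... | yes refl | _ = contradiction g≤f (<⇒≱ f<g)
... | no t₀≢ | yes g≤f′ =
  let (s , t₀<s , s≤t , eq) = crossing-upward f g f-step g-mono t₀ t (≤-pred (≤∧≢⇒< t₀≤ t₀≢)) f<g g≤f′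
  in s , t₀<s , m≤n⇒m≤1+n s≤t , eq
... | no t₀≢ | no g≰f =
  suc t , ≤∧≢⇒< t₀≤ t₀≢ , ≤-refl , ≤-antisym (≤-trans (f-step t) (≤-trans (≰⇒> g≰f) (g-mono t))) g≤f

crossing-downward : (f g : ℕ → ℕ) → (∀ t → f t ≤ suc (f (suc t))) → (∀ t → g (suc t) ≤ g t) →
                    ∀ t₀ t₁ → t₀ ≤ t₁ → g t₀ ≤ f t₀ → f t₁ < g t₁ →
                    ∃[ t ] (t₀ ≤ t × t < t₁ × f t ≡ g t)
crossing-downward f g f-step g-anti t₀ zero    z≤n g≤f f<g = contradiction g≤f (<⇒≱ f<g)
crossing-downward f g f-step g-anti t₀ (suc t) t₀≤ g≤f f<g with t₀ ≟ suc t | f t <? g t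
... | yes refl | _ = contradiction g≤f (<⇒≱ f<g)
... | no t₀≢ | yes f<g′ =
  let (s , t₀≤s , s<t , eq) = crossing-downward f g f-step g-anti t₀ t (≤-pred (≤∧≢⇒< t₀≤ t₀≢)) g≤f f<g′
  in s , t₀≤s , m≤n⇒m≤1+n s<t , eq
... | no t₀≢ | no f≮g =
  t , ≤-pred (≤∧≢⇒< t₀≤ t₀≢) , ≤-refl , ≤-antisym (≤-trans (f-step t) (≤-trans f<g (g-anti t))) (≮⇒≥ f≮g)

-- The maximal path cut into chunks

-- The edges from A_i to A_{i+1}: u_i, followed by v_i when i ≥ 1.
verticalAfter : {n : ℕ} → Fin (suc n) → List (Edge n)
verticalAfter zero    = []
verticalAfter (suc j) = ver j ∷ []

chunk : {n : ℕ} → Fin (suc n) → List (Edge n)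
chunk i = hor i ∷ verticalAfter i

chunk-nonempty : {n : ℕ} (i : Fin (suc n)) → 0 < length (chunk i)
chunk-nonempty i = s≤s z≤n

allFin-suc : ∀ n → allFin (suc n) ≡ zero ∷ map suc (allFin n)
allFin-suc n = cong (zero ∷_) (sym (map-tabulate (λ j → j) suc))

length-allFin : ∀ n → length (allFin n) ≡ n
length-allFin n = length-tabulate (λ j → j)

length-take-allFin : ∀ {k m} → k ≤ m → length (take k (allFin m)) ≡ k
length-take-allFin {k} {m} k≤m = trans (length-take k (allFin m)) (trans (cong (k ⊓_) (length-allFin m)) (m≤n⇒m⊓n≡m k≤m))

length-chunks-suc : ∀ {n} (js : List (Fin n)) → length (concatMap chunk (map suc js)) ≡ 2 * length js
length-chunks-suc []       = refl
length-chunks-suc (j ∷ js) = trans (cong (2 +_) (length-chunks-suc js)) (sym (*-suc 2 (length js)))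

edges-chunks : ∀ n → edges n ≡ concatMap chunk (allFin (suc n))
edges-chunks n = cong (hor zero ∷_) (trans (pairs (allFin n)) (cong (concatMap chunk) (map-tabulate (λ j → j) suc)))
  where
  pairs : (js : List (Fin n)) → concatMap (λ j → hor (suc j) ∷ ver j ∷ []) js ≡ concatMap chunk (map suc js)
  pairs []       = refl
  pairs (j ∷ js) = cong (λ es → hor (suc j) ∷ ver j ∷ es) (pairs js)

chunkStart-allFin : ∀ n k → k ≤ n → chunkStart chunk (suc k) (allFin (suc n)) ≡ suc (2 * k)
chunkStart-allFin n k k≤n = begin
  length (concatMap chunk (take (suc k) (allFin (suc n))))
    ≡⟨ cong (λ xs → length (concatMap chunk (take (suc k) xs))) (allFin-suc n) ⟩
  suc (length (concatMap chunk (take k (map suc (allFin n)))))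
    ≡⟨ cong (λ xs → suc (length (concatMap chunk xs))) (take-map k (allFin n)) ⟩
  suc (length (concatMap chunk (map suc (take k (allFin n)))))
    ≡⟨ cong suc (length-chunks-suc (take k (allFin n))) ⟩
  suc (2 * length (take k (allFin n)))
    ≡⟨ cong (λ l → suc (2 * l)) (length-take-allFin k≤n) ⟩
  suc (2 * k) ∎
  where open ≡-Reasoning

length-edges : ∀ n → length (edges n) ≡ suc (2 * n)
length-edges n = trans (cong length (edges-chunks n))
  (trans (cong (λ xs → length (concatMap chunk xs)) (sym (take-all (suc n) (allFin (suc n)) whole)))
         (chunkStart-allFin n n ≤-refl))
  where
  whole : suc n ≥ length (allFin (suc n))
  whole = ≤-reflexive (length-allFin (suc n))

posU-chunkStart : ∀ {n} (i : Fin (suc n)) → posU i ≡ chunkStart chunk (toℕ i) (allFin (suc n))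
posU-chunkStart         zero    = refl
posU-chunkStart {suc n} (suc j) = sym (chunkStart-allFin (suc n) (toℕ j) (<⇒≤ (toℕ<n j)))

subLen-≢ : ∀ n {p q} → p ≢ q → subLen n p q ≡ ((q + suc (2 * n)) ∸ p) % suc (2 * n)
subLen-≢ n {p} {q} p≢q with p ≡ᵇ q in eq
... | true  = contradiction (≡ᵇ⇒≡ p q (subst T (sym eq) _)) p≢q
... | false = refl

subLen-≡ : ∀ n p → subLen n p p ≡ suc (2 * n)
subLen-≡ n p with p ≡ᵇ p in eq
... | true  = refl
... | false = contradiction (subst T eq (≡⇒≡ᵇ p p refl)) λ ()

subLen-< : ∀ n {p q} → p < q → q < suc (2 * n) → subLen n p q ≡ q ∸ p
subLen-< n {p} {q} p<q q<m = begin
  subLen n p q                          ≡⟨ subLen-≢ n (<⇒≢ p<q) ⟩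
  ((q + suc (2 * n)) ∸ p) % suc (2 * n)  ≡⟨ cong (_% suc (2 * n)) (+-∸-comm (suc (2 * n)) (<⇒≤ p<q)) ⟩
  ((q ∸ p) + suc (2 * n)) % suc (2 * n)  ≡⟨ [m+n]%n≡m%n (q ∸ p) (suc (2 * n)) ⟩
  (q ∸ p) % suc (2 * n)                  ≡⟨ m<n⇒m%n≡m (≤-<-trans (m∸n≤m q p) q<m) ⟩
  q ∸ p                                  ∎
  where open ≡-Reasoning

subLen-≥ : ∀ n {p q} → q ≤ p → p < suc (2 * n) → subLen n p q ≡ (suc (2 * n) ∸ p) + q
subLen-≥ n {p} {q} q≤p p<m with p ≟ q
... | yes refl = trans (subLen-≡ n p) (sym (m∸n+n≡m (<⇒≤ p<m)))
... | no  p≢q  = begin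
  subLen n p q
    ≡⟨ subLen-≢ n p≢q ⟩
  ((q + suc (2 * n)) ∸ p) % suc (2 * n)
    ≡⟨ cong (_% suc (2 * n)) (trans (+-∸-assoc q (<⇒≤ p<m)) (+-comm q _)) ⟩
  ((suc (2 * n) ∸ p) + q) % suc (2 * n)
    ≡⟨ m<n⇒m%n≡m short ⟩
  (suc (2 * n) ∸ p) + q                  ∎
  where
  open ≡-Reasoning
  short : (suc (2 * n) ∸ p) + q < suc (2 * n)
  short = subst ((suc (2 * n) ∸ p) + q <_) (m∸n+n≡m (<⇒≤ p<m))
            (+-monoʳ-< (suc (2 * n) ∸ p) (≤∧≢⇒< q≤p (≢-sym p≢q)))

subpath-cyclicSlice : ∀ n {p q} → p < suc (2 * n) → q < suc (2 * n) →
                      subpath n p q ≡ cyclicSlice p q (edges n)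
subpath-cyclicSlice n {p} {q} p<m q<m = by-cases (p <? q)
  where
  open ≡-Reasoning
  E : List (Edge n)
  E = edges n
  p≤E : p ≤ length E
  p≤E = ≤-trans (<⇒≤ p<m) (≤-reflexive (sym (length-edges n)))
  by-cases : Dec (p < q) → subpath n p q ≡ cyclicSlice p q E
  by-cases (yes p<q) = begin
    take (subLen n p q) (drop p (E ++ E)) ≡⟨ cong₂ take (subLen-< n p<q q<m) (drop-++-≤ p E E p≤E) ⟩
    take (q ∸ p) (drop p E ++ E)          ≡⟨ take-++-≤ (q ∸ p) (drop p E) E fits ⟩
    take (q ∸ p) (drop p E)               ≡⟨ take-drop (q ∸ p) p E ⟩
    drop p (take (p + (q ∸ p)) E)         ≡⟨ cong (λ k → drop p (take k E)) (m+[n∸m]≡n (<⇒≤ p<q)) ⟩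
    drop p (take q E)                     ≡⟨ sym (cyclicSlice-< E p<q) ⟩
    cyclicSlice p q E                     ∎
    where
    fits : q ∸ p ≤ length (drop p E)
    fits = subst (q ∸ p ≤_) (sym (trans (length-drop p E) (cong (_∸ p) (length-edges n))))
             (∸-monoˡ-≤ p (<⇒≤ q<m))
  by-cases (no p≮q) = begin
    take (subLen n p q) (drop p (E ++ E))
      ≡⟨ cong₂ take (subLen-≥ n (≮⇒≥ p≮q) p<m) (drop-++-≤ p E E p≤E) ⟩
    take (suc (2 * n) ∸ p + q) (drop p E ++ E)
      ≡⟨ cong (λ l → take (l + q) (drop p E ++ E)) rest ⟩
    take (length (drop p E) + q) (drop p E ++ E)
      ≡⟨ take-++-length (drop p E) q E ⟩
    drop p E ++ take q E
      ≡⟨ sym (cyclicSlice-≥ E (≮⇒≥ p≮q)) ⟩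
    cyclicSlice p q E                          ∎
    where
    rest : suc (2 * n) ∸ p ≡ length (drop p E)
    rest = sym (trans (length-drop p E) (cong (_∸ p) (length-edges n)))

-- The chunk starting at the upper endpoint A_{j+2} of v_{j+1}, cyclically.
chunkAfter : (n : ℕ) → Fin n → ℕ
chunkAfter n j = (2 + toℕ j) % suc n

chunkAfter-inner : ∀ n (j : Fin n) → 2 + toℕ j ≤ n → chunkAfter n j ≡ 2 + toℕ j
chunkAfter-inner n j inner = m<n⇒m%n≡m (s≤s inner)

chunkAfter-last : ∀ n (j : Fin n) → suc (toℕ j) ≡ n → chunkAfter n j ≡ 0
chunkAfter-last n j last = trans (cong (λ k → suc k % suc n) last) (n%n≡0 (suc n))

last-or-inner : ∀ {n} (j : Fin n) → 2 + toℕ j ≰ n → suc (toℕ j) ≡ n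
last-or-inner j not-inner = ≤-antisym (toℕ<n j) (≤-pred (≰⇒> not-inner))

posF-chunkStart : ∀ n (j : Fin n) → posF n j ≡ chunkStart chunk (chunkAfter n j) (allFin (suc n))
posF-chunkStart n j with 2 + toℕ j ≤? n
... | yes inner = begin
  (3 + 2 * toℕ j) % suc (2 * n)
    ≡⟨ m<n⇒m%n≡m (s≤s (≤-trans (n≤1+n _) (subst (_≤ 2 * n) twice (*-monoʳ-≤ 2 inner)))) ⟩
  3 + 2 * toℕ j
    ≡⟨ cong suc (sym (*-suc 2 (toℕ j))) ⟩
  suc (2 * suc (toℕ j))
    ≡⟨ sym (chunkStart-allFin n (suc (toℕ j)) (<⇒≤ inner)) ⟩
  chunkStart chunk (2 + toℕ j) (allFin (suc n))
    ≡⟨ cong (λ k → chunkStart chunk k (allFin (suc n))) (sym (chunkAfter-inner n j inner)) ⟩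
  chunkStart chunk (chunkAfter n j) (allFin (suc n)) ∎
  where
  open ≡-Reasoning
  twice : 2 * (2 + toℕ j) ≡ 4 + 2 * toℕ j
  twice = trans (*-suc 2 (suc (toℕ j))) (cong (2 +_) (*-suc 2 (toℕ j)))
... | no not-inner = begin
  (3 + 2 * toℕ j) % suc (2 * n)
    ≡⟨ cong (λ k → suc k % suc (2 * n)) (sym (*-suc 2 (toℕ j))) ⟩
  suc (2 * suc (toℕ j)) % suc (2 * n)
    ≡⟨ cong (λ k → suc (2 * k) % suc (2 * n)) (last-or-inner j not-inner) ⟩
  suc (2 * n) % suc (2 * n)
    ≡⟨ n%n≡0 (suc (2 * n)) ⟩
  0
    ≡⟨ cong (λ k → chunkStart chunk k (allFin (suc n))) (sym (chunkAfter-last n j (last-or-inner j not-inner))) ⟩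
  chunkStart chunk (chunkAfter n j) (allFin (suc n)) ∎
  where open ≡-Reasoning

window : {n : ℕ} → Fin (suc n) → Fin n → List (Fin (suc n))
window {n} i j = cyclicSlice (toℕ i) (chunkAfter n j) (allFin (suc n))

subpath-window : ∀ n (i : Fin (suc n)) (j : Fin n) → subpath n (posU i) (posF n j) ≡ concatMap chunk (window i j)
subpath-window n i j = begin
  subpath n (posU i) (posF n j)
    ≡⟨ subpath-cyclicSlice n (posU<m i) (m%n<n (3 + 2 * toℕ j) (suc (2 * n))) ⟩
  cyclicSlice (posU i) (posF n j) (edges n)
    ≡⟨ cong₂ (λ p q → cyclicSlice p q (edges n)) (posU-chunkStart i) (posF-chunkStart n j) ⟩
  cyclicSlice (chunkStart chunk (toℕ i) all) (chunkStart chunk (chunkAfter n j) all) (edges n)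
    ≡⟨ cong (cyclicSlice (chunkStart chunk (toℕ i) all) (chunkStart chunk (chunkAfter n j) all)) (edges-chunks n) ⟩
  cyclicSlice (chunkStart chunk (toℕ i) all) (chunkStart chunk (chunkAfter n j) all) (concatMap chunk all)
    ≡⟨ concatMap-cyclicSlice chunk chunk-nonempty (toℕ i) (chunkAfter n j) all after≤ ⟩
  concatMap chunk (window i j) ∎
  where
  open ≡-Reasoning
  all : List (Fin (suc n))
  all = allFin (suc n)
  after≤ : chunkAfter n j ≤ length all
  after≤ = ≤-trans (<⇒≤ (m%n<n (2 + toℕ j) (suc n))) (≤-reflexive (sym (length-allFin (suc n))))
  posU<m : (i : Fin (suc n)) → posU i < suc (2 * n)
  posU<m zero    = s≤s z≤n
  posU<m (suc k) = s≤s (*-monoʳ-< 2 (toℕ<n k))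

window-≤ : ∀ {n} (i : Fin (suc n)) (j : Fin n) → toℕ i ≤ suc (toℕ j) →
           window i j ≡ drop (toℕ i) (take (2 + toℕ j) (allFin (suc n)))
window-≤ {n} i j i≤ with 2 + toℕ j ≤? n
... | yes inner rewrite chunkAfter-inner n j inner = cyclicSlice-< (allFin (suc n)) (s≤s i≤)
... | no not-inner rewrite chunkAfter-last n j (last-or-inner j not-inner) = begin
  drop (toℕ i) (allFin (suc n)) ++ []
    ≡⟨ ++-identityʳ _ ⟩
  drop (toℕ i) (allFin (suc n))
    ≡⟨ cong (drop (toℕ i)) (sym (take-all _ (allFin (suc n)) whole)) ⟩
  drop (toℕ i) (take (2 + toℕ j) (allFin (suc n))) ∎
  where
  open ≡-Reasoning
  whole : 2 + toℕ j ≥ length (allFin (suc n))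
  whole = ≤-reflexive (trans (length-allFin (suc n)) (cong suc (sym (last-or-inner j not-inner))))

window-> : ∀ {n} (i : Fin (suc n)) (j : Fin n) → suc (toℕ j) < toℕ i →
           window i j ≡ drop (toℕ i) (allFin (suc n)) ++ take (2 + toℕ j) (allFin (suc n))
window-> {n} i j j<i rewrite chunkAfter-inner n j (≤-trans j<i (≤-pred (toℕ<n i))) =
  cyclicSlice-≥ (allFin (suc n)) j<i

Consecutive : {m : ℕ} → Fin m → Fin m → Set
Consecutive x y = toℕ y ≡ suc (toℕ x)

tabulate-consecutive : ∀ {m k} (f : Fin (suc m) → Fin k) →
                       (∀ i → toℕ (f (suc i)) ≡ suc (toℕ (f (inject₁ i)))) → Linked Consecutive (tabulate f)
tabulate-consecutive {zero}  f step = [-]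
tabulate-consecutive {suc m} f step = step zero ∷ tabulate-consecutive (λ i → f (suc i)) (λ i → step (suc i))

allFin-consecutive : ∀ n → Linked Consecutive (allFin (suc n))
allFin-consecutive n = tabulate-consecutive (λ i → i) (λ i → cong suc (sym (toℕ-inject₁ i)))

CyclicSucc : {n : ℕ} → Fin (suc n) → Fin (suc n) → Set
CyclicSucc x y = Consecutive x y ⊎ y ≡ zero

cyclicSlice-linked : ∀ {n} a b → Linked CyclicSucc (cyclicSlice a b (allFin (suc n)))
cyclicSlice-linked {n} a b = by-cases (a <? b)
  where
  consecutive : Linked CyclicSucc (allFin (suc n))
  consecutive = Linked.map inj₁ (allFin-consecutive n)
  into-zero : ∀ mx b → Connected CyclicSucc mx (head (take b (allFin (suc n))))
  into-zero nothing  zero    = nothing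
  into-zero (just x) zero    = just-nothing
  into-zero nothing  (suc b) = nothing-just
  into-zero (just x) (suc b) = just (inj₂ refl)
  by-cases : Dec (a < b) → Linked CyclicSucc (cyclicSlice a b (allFin (suc n)))
  by-cases (yes a<b) rewrite cyclicSlice-< (allFin (suc n)) a<b = Linked-drop a (Linked-take b consecutive)
  by-cases (no a≮b) rewrite cyclicSlice-≥ (allFin (suc n)) (≮⇒≥ a≮b) =
    ++⁺ (Linked-drop a consecutive) (into-zero _ b) (Linked-take b consecutive)

isZero : {n : ℕ} → Fin (suc n) → Bool
isZero zero    = true
isZero (suc _) = false

count-isZero-allFin : ∀ n → count isZero (allFin (suc n)) ≡ 1
count-isZero-allFin n = cong suc (trans (cong (count isZero) (sym (map-tabulate {n = n} (λ i → i) suc))) (none (allFin n)))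
  where
  none : (xs : List (Fin n)) → count isZero (map suc xs) ≡ 0
  none []       = refl
  none (x ∷ xs) = none xs

take-allFin-last : ∀ {n} (j : Fin n) →
                   take (2 + toℕ j) (allFin (suc n)) ≡ take (suc (toℕ j)) (allFin (suc n)) ++ suc j ∷ []
take-allFin-last j = take-suc-tabulate (λ i → i) (suc j)

module _ {n : ℕ} (i : Fin (suc n)) (j : Fin n) where

  window-linked : Linked CyclicSucc (window i j)
  window-linked = cyclicSlice-linked (toℕ i) (chunkAfter n j)

  window-zeros : count isZero (window i j) ≤ 1
  window-zeros = subst (count isZero (window i j) ≤_) (count-isZero-allFin n)
                   (count-cyclicSlice-≤ isZero (toℕ i) (chunkAfter n j) (allFin (suc n)))

  window-length : toℕ i ≤ suc (toℕ j) → length (window i j) ≡ 2 + toℕ j ∸ toℕ i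
  window-length i≤ = begin
    length (window i j)
      ≡⟨ cong length (window-≤ i j i≤) ⟩
    length (drop (toℕ i) (take (2 + toℕ j) (allFin (suc n))))
      ≡⟨ length-drop (toℕ i) _ ⟩
    length (take (2 + toℕ j) (allFin (suc n))) ∸ toℕ i
      ≡⟨ cong (_∸ toℕ i) (length-take-allFin (s≤s (toℕ<n j))) ⟩
    2 + toℕ j ∸ toℕ i                                         ∎
    where open ≡-Reasoning

  window-head : ∃[ tl ] window i j ≡ i ∷ tl
  window-head with toℕ i ≤? suc (toℕ j)
  ... | yes i≤ = _ , (begin
    window i j
      ≡⟨ window-≤ i j i≤ ⟩
    drop (toℕ i) (take (2 + toℕ j) (allFin (suc n)))
      ≡⟨ cong (λ k → drop (toℕ i) (take k (allFin (suc n)))) (sym (m+[n∸m]≡n (m≤n⇒m≤1+n i≤))) ⟩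
    drop (toℕ i) (take (toℕ i + (2 + toℕ j ∸ toℕ i)) (allFin (suc n)))
      ≡⟨ sym (take-drop (2 + toℕ j ∸ toℕ i) (toℕ i) (allFin (suc n))) ⟩
    take (2 + toℕ j ∸ toℕ i) (drop (toℕ i) (allFin (suc n)))
      ≡⟨ cong₂ take (+-∸-assoc 1 i≤) (drop-tabulate (λ k → k) i) ⟩
    i ∷ take (suc (toℕ j) ∸ toℕ i) (drop (suc (toℕ i)) (allFin (suc n))) ∎)
    where open ≡-Reasoning
  ... | no i≰ = _ , trans (window-> i j (≰⇒> i≰))
                          (cong (_++ take (2 + toℕ j) (allFin (suc n))) (drop-tabulate (λ k → k) i))

  window-last : ∃[ ini ] window i j ≡ ini ++ suc j ∷ []
  window-last with toℕ i ≤? suc (toℕ j)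
  ... | yes i≤ = _ , (begin
    window i j
      ≡⟨ window-≤ i j i≤ ⟩
    drop (toℕ i) (take (2 + toℕ j) (allFin (suc n)))
      ≡⟨ cong (drop (toℕ i)) (take-allFin-last j) ⟩
    drop (toℕ i) (take (suc (toℕ j)) (allFin (suc n)) ++ suc j ∷ [])
      ≡⟨ drop-++-≤ (toℕ i) _ _ (subst (toℕ i ≤_) (sym (length-take-allFin (s≤s (<⇒≤ (toℕ<n j))))) i≤) ⟩
    drop (toℕ i) (take (suc (toℕ j)) (allFin (suc n))) ++ suc j ∷ [] ∎)
    where open ≡-Reasoning
  ... | no i≰ = _ , (begin
    window i j
      ≡⟨ window-> i j (≰⇒> i≰) ⟩
    drop (toℕ i) (allFin (suc n)) ++ take (2 + toℕ j) (allFin (suc n))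
      ≡⟨ cong (drop (toℕ i) (allFin (suc n)) ++_) (take-allFin-last j) ⟩
    drop (toℕ i) (allFin (suc n)) ++ (take (suc (toℕ j)) (allFin (suc n)) ++ suc j ∷ [])
      ≡⟨ sym (++-assoc (drop (toℕ i) (allFin (suc n))) _ _) ⟩
    (drop (toℕ i) (allFin (suc n)) ++ take (suc (toℕ j)) (allFin (suc n))) ++ suc j ∷ [] ∎)
    where open ≡-Reasoning

-- Compatibility is separation

Separated : (n : ℕ) → Subset (suc n) → Subset n → Set
Separated n S1 S2 = (j : Fin n) → lookup S2 j ≡ true → lookup S1 (suc j) ≡ false × lookup S1 (inject₁ j) ≡ false

-- Compatible n S1 S2 unfolds to BalancedCut S1 S2 P for every subpath P from
-- some u ∈ S1 to some v ∈ S2.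
BalancedCut : {n : ℕ} → Subset (suc n) → Subset n → List (Edge n) → Set
BalancedCut S1 S2 P =
  ∃[ t ] (0 < t × t < length P ×
          (count isH (drop t P) ≡ 2 * count (inS2 S2) (drop t P)
           ⊎ count isV (take t P) ≡ 2 * count (inS1 S1) (take t P)))

Imbalanced : {n : ℕ} → Subset (suc n) → Subset n → List (Edge n) → Set
Imbalanced S1 S2 P = 2 * count (inS1 S1) P < count isV P ⊎ 2 * count (inS2 S2) P < count isH P

module Cuts {n : ℕ} (S1 : Subset (suc n)) (S2 : Subset n) (i : Fin (suc n)) (j : Fin n) (Q : List (Edge n))
            (u∈S1 : lookup S1 i ≡ true) (v∈S2 : lookup S2 j ≡ true) where

  P : List (Edge n)
  P = hor i ∷ Q ++ ver j ∷ []

  within : ∀ {t} → t < length (Q ++ ver j ∷ []) → t ≤ length Q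
  within t< = ≤-pred (subst (_ <_) (trans (length-++ Q) (+-comm (length Q) 1)) t<)

  two≰one : ¬ (2 ≤ 1)
  two≰one (s≤s ())

  short : suc (length Q) < length P
  short = s≤s (subst (length Q <_) (sym (trans (length-++ Q) (+-comm (length Q) 1))) ≤-refl)

  -- u ∈ S1 makes 2|S1 ∩ EA| win at the first cut, v ∈ S2 makes 2|S2 ∩ AF| win
  -- at the last one; the imbalance reverses one of them at the other end.
  balancedCut-from-imbalance : Imbalanced S1 S2 P → BalancedCut S1 S2 P
  balancedCut-from-imbalance (inj₁ lt) =
    let (t , 1<t , t≤ , eq) = crossing-upward f g (λ t → count-take-suc-≤ isV t P)
                                (λ t → *-monoʳ-≤ 2 (count-take-mono (inS1 S1) t P))
                                1 (suc (length Q)) (s≤s z≤n) at-first at-last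
    in t , <-trans (s≤s z≤n) 1<t , ≤-<-trans t≤ short , inj₂ eq
    where
    f g : ℕ → ℕ
    f t = count isV (take t P)
    g t = 2 * count (inS1 S1) (take t P)
    at-first : f 1 < g 1
    at-first rewrite u∈S1 = s≤s z≤n
    at-last : g (suc (length Q)) ≤ f (suc (length Q))
    at-last = subst (λ R → 2 * count (inS1 S1) R ≤ count isV R) (sym (cong (hor i ∷_) (take-length-++ Q (ver j ∷ []))))
             (≤-pred (subst₂ (λ c v → 2 * c < v) (trans (count-++ (inS1 S1) (hor i ∷ Q) (ver j ∷ [])) (+-identityʳ _))
                       (trans (count-++ isV (hor i ∷ Q) (ver j ∷ [])) (+-comm _ 1)) lt))
  balancedCut-from-imbalance (inj₂ lt) =
    let (t , 1≤t , t< , eq) = crossing-downward f g (λ t → count-drop-≤-suc isH t P)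
                                (λ t → *-monoʳ-≤ 2 (count-drop-antimono (inS2 S2) t P))
                                1 (suc (length Q)) (s≤s z≤n) (≤-pred lt) at-last
    in t , 1≤t , <-trans t< short , inj₁ eq
    where
    f g : ℕ → ℕ
    f t = count isH (drop t P)
    g t = 2 * count (inS2 S2) (drop t P)
    final : count isH (ver j ∷ []) < 2 * count (inS2 S2) (ver j ∷ [])
    final rewrite v∈S2 = s≤s z≤n
    at-last : f (suc (length Q)) < g (suc (length Q))
    at-last = subst (λ R → count isH R < 2 * count (inS2 S2) R) (sym (drop-length-++ Q (ver j ∷ []))) final

  no-balancedCut-if-short : count isH Q ≤ 1 → count isV Q ≤ 1 → ¬ BalancedCut S1 S2 P
  no-balancedCut-if-short h≤1 _ (suc t , _ , s≤s t< , inj₁ eq) = two≰one (begin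
    2
      ≤⟨ *-monoʳ-≤ 2 marked ⟩
    2 * count (inS2 S2) (drop t Q ++ ver j ∷ [])
      ≡⟨ sym (subst (λ R → count isH R ≡ 2 * count (inS2 S2) R) (drop-++-≤ t Q _ (within t<)) eq) ⟩
    count isH (drop t Q ++ ver j ∷ [])
      ≡⟨ trans (count-++ isH (drop t Q) _) (+-identityʳ _) ⟩
    count isH (drop t Q)
      ≤⟨ ≤-trans (count-drop-≤ isH t Q) h≤1 ⟩
    1                                                ∎)
    where
    open ≤-Reasoning
    marked : 1 ≤ count (inS2 S2) (drop t Q ++ ver j ∷ [])
    marked = subst (1 ≤_)
               (sym (trans (count-++ (inS2 S2) (drop t Q) _) (cong (count (inS2 S2) (drop t Q) +_) (count-∷-true (inS2 S2) [] v∈S2))))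
               (m≤n+m 1 _)
  no-balancedCut-if-short _ v≤1 (suc t , _ , s≤s t< , inj₂ eq) = two≰one (begin
    2
      ≤⟨ *-monoʳ-≤ 2 (subst (1 ≤_) (sym z≡) (s≤s z≤n)) ⟩
    2 * count (inS1 S1) (hor i ∷ take t Q)
      ≡⟨ sym (subst (λ R → count isV (hor i ∷ R) ≡ 2 * count (inS1 S1) (hor i ∷ R)) (take-++-≤ t Q _ (within t<)) eq) ⟩
    count isV (take t Q)
      ≤⟨ ≤-trans (count-take-≤-all isV t Q) v≤1 ⟩
    1                                                ∎)
    where
    open ≤-Reasoning
    z≡ : count (inS1 S1) (hor i ∷ take t Q) ≡ suc (count (inS1 S1) (take t Q))
    z≡ = count-∷-true (inS1 S1) (take t Q) u∈S1

count-isH-chunks : ∀ {n} (w : List (Fin (suc n))) → count isH (concatMap chunk w) ≡ length w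
count-isH-chunks []            = refl
count-isH-chunks (zero  ∷ w) = cong suc (count-isH-chunks w)
count-isH-chunks (suc _ ∷ w) = cong suc (count-isH-chunks w)

count-isV-chunks : ∀ {n} (w : List (Fin (suc n))) → count isV (concatMap chunk w) + count isZero w ≡ length w
count-isV-chunks []            = refl
count-isV-chunks (zero  ∷ w) = trans (+-suc _ _) (cong suc (count-isV-chunks w))
count-isV-chunks (suc _ ∷ w) = cong suc (count-isV-chunks w)

window-shape : ∀ {n} (i : Fin (suc n)) (j : Fin n) → ∃[ Q ] concatMap chunk (window i j) ≡ hor i ∷ Q ++ ver j ∷ []
window-shape i j with window-head i j | window-last i j
... | tl , w≡i∷tl | ini , w≡ini∷ʳ rewrite w≡ini∷ʳ = shape ini w≡i∷tl
  where
  shape : ∀ ini → ini ++ suc j ∷ [] ≡ i ∷ tl → ∃[ Q ] concatMap chunk (ini ++ suc j ∷ []) ≡ hor i ∷ Q ++ ver j ∷ []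
  shape []        eq rewrite proj₁ (∷-injective eq) = [] , refl
  shape (x ∷ ini) eq rewrite proj₁ (∷-injective eq) =
    verticalAfter i ++ concatMap chunk ini ++ hor (suc j) ∷ [] , cong (hor i ∷_) (begin
      verticalAfter i ++ concatMap chunk (ini ++ suc j ∷ [])
        ≡⟨ cong (verticalAfter i ++_) (concatMap-++ chunk ini (suc j ∷ [])) ⟩
      verticalAfter i ++ concatMap chunk ini ++ hor (suc j) ∷ ver j ∷ []
        ≡⟨ cong (verticalAfter i ++_) (sym (++-assoc (concatMap chunk ini) (hor (suc j) ∷ []) (ver j ∷ []))) ⟩
      verticalAfter i ++ (concatMap chunk ini ++ hor (suc j) ∷ []) ++ ver j ∷ []
        ≡⟨ sym (++-assoc (verticalAfter i) _ (ver j ∷ [])) ⟩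
      (verticalAfter i ++ concatMap chunk ini ++ hor (suc j) ∷ []) ++ ver j ∷ [] ∎)
    where open ≡-Reasoning

marked : {n : ℕ} → Subset (suc n) → Subset n → Edge n → Bool
marked S1 S2 (hor i) = lookup S1 i
marked S1 S2 (ver j) = lookup S2 j

count-marked : ∀ {n} (S1 : Subset (suc n)) (S2 : Subset n) P →
               count (marked S1 S2) P ≡ count (inS1 S1) P + count (inS2 S2) P
count-marked S1 S2 []          = refl
count-marked S1 S2 (hor i ∷ P) with lookup S1 i
... | true  = cong suc (count-marked S1 S2 P)
... | false = count-marked S1 S2 P
count-marked S1 S2 (ver j ∷ P) with lookup S2 j
... | true  = trans (cong suc (count-marked S1 S2 P)) (sym (+-suc _ _))
... | false = count-marked S1 S2 P

unbalanced : ∀ {m v z c₁ c₂} → v + z ≡ m → z ≤ 1 → c₁ + c₂ < m → 2 * c₁ < v ⊎ 2 * c₂ < m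
unbalanced {m} {v} {z} {c₁} {c₂} v+z≡m z≤1 c< with 2 * c₁ <? v
... | yes 2c₁<v = inj₁ 2c₁<v
... | no  2c₁≮v = inj₂ (+-cancelˡ-≤ m _ _ (begin
  m + suc (2 * c₂)          ≤⟨ +-monoˡ-≤ (suc (2 * c₂)) m≤ ⟩
  2 * c₁ + 1 + suc (2 * c₂) ≡⟨ regroup c₁ c₂ ⟩
  2 * suc (c₁ + c₂)         ≤⟨ *-monoʳ-≤ 2 c< ⟩
  2 * m                     ≡⟨ cong (m +_) (+-identityʳ m) ⟩
  m + m                     ∎))
  where
  open ≤-Reasoning
  m≤ : m ≤ 2 * c₁ + 1
  m≤ = subst (_≤ 2 * c₁ + 1) v+z≡m (+-mono-≤ (≮⇒≥ 2c₁≮v) z≤1)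
  regroup : ∀ a b → 2 * a + 1 + suc (2 * b) ≡ 2 * suc (a + b)
  regroup = solve-∀

module Marks {n : ℕ} (S1 : Subset (suc n)) (S2 : Subset n) (sep : Separated n S1 S2) where

  chunk-marks-≤1 : ∀ x → count (marked S1 S2) (chunk x) ≤ 1
  chunk-marks-≤1 zero with lookup S1 zero
  ... | true  = ≤-refl
  ... | false = z≤n
  chunk-marks-≤1 (suc k) with lookup S1 (suc k) in u | lookup S2 k in v
  ... | true  | true  = contradiction (trans (sym u) (proj₁ (sep k v))) λ ()
  ... | true  | false = ≤-refl
  ... | false | true  = ≤-refl
  ... | false | false = z≤n

  chunk-marks-u : ∀ x → lookup S1 x ≡ true → count (marked S1 S2) (chunk x) ≡ 1
  chunk-marks-u zero    u rewrite u = refl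
  chunk-marks-u (suc k) u with lookup S2 k in v
  ... | true  = contradiction (trans (sym u) (proj₁ (sep k v))) λ ()
  ... | false rewrite u = refl

  chunk-marks-after-u : ∀ x y → lookup S1 x ≡ true → CyclicSucc x y → lookup S1 y ≡ false →
                        count (marked S1 S2) (chunk y) ≡ 0
  chunk-marks-after-u x zero    u _              u′ rewrite u′ = refl
  chunk-marks-after-u x (suc k) u (inj₁ x→y) u′ with lookup S2 k in v
  ... | true  = contradiction (trans (sym u) (trans (cong (lookup S1) x≡) (proj₂ (sep k v)))) λ ()
    where
    x≡ : x ≡ inject₁ k
    x≡ = toℕ-injective (trans (suc-injective (sym x→y)) (sym (toℕ-inject₁ k)))
  ... | false rewrite u′ = refl

  marks-≤-length : ∀ w → count (marked S1 S2) (concatMap chunk w) ≤ length w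
  marks-≤-length []      = z≤n
  marks-≤-length (x ∷ w) = subst (_≤ suc (length w)) (sym (count-++ (marked S1 S2) (chunk x) (concatMap chunk w)))
                             (+-mono-≤ (chunk-marks-≤1 x) (marks-≤-length w))

  -- No u-marked chunk is followed by a v-marked one, so some chunk between the
  -- first (u-marked) and the last (v-marked) carries no mark.
  marks-<-length : ∀ {j} x w → Linked CyclicSucc (x ∷ w) → lookup S1 x ≡ true →
                   last (x ∷ w) ≡ just (suc j) → lookup S2 j ≡ true →
                   count (marked S1 S2) (concatMap chunk (x ∷ w)) < suc (length w)
  marks-<-length {j} x [] _ u x≡ v rewrite just-injective x≡ = contradiction (trans (sym u) (proj₁ (sep j v))) λ ()
  marks-<-length x (y ∷ w) (x→y ∷ linked) u ends v = begin-strict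
    count (marked S1 S2) (chunk x ++ concatMap chunk (y ∷ w))
      ≡⟨ count-++ (marked S1 S2) (chunk x) _ ⟩
    count (marked S1 S2) (chunk x) + count (marked S1 S2) (concatMap chunk (y ∷ w))
      ≡⟨ cong (_+ _) (chunk-marks-u x u) ⟩
    suc (count (marked S1 S2) (concatMap chunk (y ∷ w)))
      <⟨ s≤s (rest (lookup S1 y) refl) ⟩
    suc (suc (length w))                                                     ∎
    where
    open ≤-Reasoning
    rest : ∀ b → lookup S1 y ≡ b → count (marked S1 S2) (concatMap chunk (y ∷ w)) < suc (length w)
    rest true  u′ = marks-<-length y w linked u′ ends v
    rest false u′ = begin-strict
      count (marked S1 S2) (chunk y ++ concatMap chunk w)
        ≡⟨ count-++ (marked S1 S2) (chunk y) _ ⟩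
      count (marked S1 S2) (chunk y) + count (marked S1 S2) (concatMap chunk w)
        ≡⟨ cong (_+ _) (chunk-marks-after-u x y u x→y u′) ⟩
      count (marked S1 S2) (concatMap chunk w)
        ≤⟨ marks-≤-length w ⟩
      length w
        <⟨ ≤-refl ⟩
      suc (length w)                                                          ∎

  imbalanced-chunks : ∀ {j} x w → Linked CyclicSucc (x ∷ w) → count isZero (x ∷ w) ≤ 1 → lookup S1 x ≡ true →
                      last (x ∷ w) ≡ just (suc j) → lookup S2 j ≡ true → Imbalanced S1 S2 (concatMap chunk (x ∷ w))
  imbalanced-chunks x w linked zeros u ends v =
    subst (λ h → 2 * count (inS1 S1) P < count isV P ⊎ 2 * count (inS2 S2) P < h) (sym (count-isH-chunks (x ∷ w)))
      (unbalanced {c₁ = count (inS1 S1) P} {c₂ = count (inS2 S2) P} (count-isV-chunks (x ∷ w)) zeros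
        (subst (_< suc (length w)) (count-marked S1 S2 P) (marks-<-length x w linked u ends v)))
    where
    P : List (Edge n)
    P = concatMap chunk (x ∷ w)

  window-imbalanced : ∀ i j → lookup S1 i ≡ true → lookup S2 j ≡ true → Imbalanced S1 S2 (concatMap chunk (window i j))
  window-imbalanced i j u v with window-head i j | window-last i j
  ... | tl , w≡ | ini , w≡′ =
    subst (λ w → Imbalanced S1 S2 (concatMap chunk w)) (sym w≡)
      (imbalanced-chunks i tl (subst (Linked CyclicSucc) w≡ (window-linked i j))
        (subst (λ w → count isZero w ≤ 1) w≡ (window-zeros i j)) u
        (trans (cong last (trans (sym w≡) w≡′)) (last-∷ʳ ini (suc j))) v)

separated⇒compatible : ∀ n S1 S2 → Separated n S1 S2 → Compatible n S1 S2
separated⇒compatible n S1 S2 sep i j i∈S1 j∈S2 with window-shape i j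
... | Q , shape =
  subst (BalancedCut S1 S2) (sym (trans (subpath-window n i j) shape))
    (Cuts.balancedCut-from-imbalance S1 S2 i j Q u v
      (subst (Imbalanced S1 S2) shape (Marks.window-imbalanced S1 S2 sep i j u v)))
  where
  u : lookup S1 i ≡ true
  u = []=⇒lookup i∈S1
  v : lookup S2 j ≡ true
  v = []=⇒lookup j∈S2

short-window-no-balancedCut : ∀ {n} (S1 : Subset (suc n)) (S2 : Subset n) i j → length (window i j) ≤ 2 →
                              lookup S1 i ≡ true → lookup S2 j ≡ true → ¬ BalancedCut S1 S2 (concatMap chunk (window i j))
short-window-no-balancedCut S1 S2 i j short u v cut with window-shape i j
... | Q , shape = Cuts.no-balancedCut-if-short S1 S2 i j Q u v horizontals verticals (subst (BalancedCut S1 S2) shape cut)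
  where
  w : List (Fin (suc _))
  w = window i j
  horizontals : count isH Q ≤ 1
  horizontals = ≤-pred (begin
    suc (count isH Q)
      ≡⟨ cong suc (sym (trans (count-++ isH Q (ver j ∷ [])) (+-identityʳ _))) ⟩
    count isH (hor i ∷ Q ++ ver j ∷ [])
      ≡⟨ cong (count isH) (sym shape) ⟩
    count isH (concatMap chunk w)
      ≡⟨ count-isH-chunks w ⟩
    length w
      ≤⟨ short ⟩
    2                                      ∎)
    where open ≤-Reasoning
  verticals : count isV Q ≤ 1
  verticals = ≤-pred (begin
    suc (count isV Q)                      ≡⟨ +-comm 1 _ ⟩
    count isV Q + 1                        ≡⟨ sym (count-++ isV Q (ver j ∷ [])) ⟩
    count isV (hor i ∷ Q ++ ver j ∷ [])    ≡⟨ cong (count isV) (sym shape) ⟩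
    count isV (concatMap chunk w)          ≤⟨ m≤m+n _ _ ⟩
    count isV (concatMap chunk w) + count isZero w ≡⟨ count-isV-chunks w ⟩
    length w                               ≤⟨ short ⟩
    2                                      ∎)
    where open ≤-Reasoning

compatible⇒separated : ∀ n S1 S2 → Compatible n S1 S2 → Separated n S1 S2
compatible⇒separated n S1 S2 compat j v =
  unmarked (suc j) (n≤1+n _) ≤-refl ,
  unmarked (inject₁ j) (≤-reflexive (sym (toℕ-inject₁ j))) (≤-trans (≤-reflexive (toℕ-inject₁ j)) (n≤1+n _))
  where
  unmarked : ∀ i → toℕ j ≤ toℕ i → toℕ i ≤ suc (toℕ j) → lookup S1 i ≡ false
  unmarked i lo hi = by-cases (lookup S1 i) refl
    where
    short : length (window i j) ≤ 2
    short = begin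
      length (window i j)     ≡⟨ window-length i j hi ⟩
      2 + toℕ j ∸ toℕ i       ≤⟨ ∸-monoʳ-≤ (2 + toℕ j) lo ⟩
      2 + toℕ j ∸ toℕ j       ≡⟨ m+n∸n≡m 2 (toℕ j) ⟩
      2                       ∎
      where open ≤-Reasoning
    by-cases : ∀ b → lookup S1 i ≡ b → lookup S1 i ≡ false
    by-cases true  u = contradiction (subst (BalancedCut S1 S2) (subpath-window n i j)
                                        (compat i j (lookup⇒[]= i S1 u) (lookup⇒[]= j S2 v)))
                                     (short-window-no-balancedCut S1 S2 i j short u v)
    by-cases false u = u

-- Words

letter : Bool → Bool → Letter
letter true  _     = U
letter false true  = V
letter false false = O

letters : ∀ {n} → Vec Bool n → Vec Bool n → List Letter
letters []      []      = []
letters (a ∷ s) (b ∷ r) = letter a b ∷ letters s r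

wordOf : ∀ {n} → Bool → Vec Bool n → Vec Bool n → List Letter
wordOf b₀ s r = letter0 b₀ ∷ letters s r

-- Separation read left to right; p records whether the previous u is in S1.
SeparatedFrom : ∀ {n} → Bool → Vec Bool n → Vec Bool n → Set
SeparatedFrom p []      []      = ⊤
SeparatedFrom p (a ∷ s) (b ∷ r) = (b ≡ true → a ≡ false × p ≡ false) × SeparatedFrom a s r

separated⇒separatedFrom : ∀ {n} b₀ (s r : Vec Bool n) → Separated n (b₀ ∷ s) r → SeparatedFrom b₀ s r
separated⇒separatedFrom b₀ []      []      sep = tt
separated⇒separatedFrom b₀ (a ∷ s) (b ∷ r) sep = sep zero , separated⇒separatedFrom a s r (λ j → sep (suc j))

separatedFrom⇒separated : ∀ {n} b₀ (s r : Vec Bool n) → SeparatedFrom b₀ s r → Separated n (b₀ ∷ s) r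
separatedFrom⇒separated b₀ (a ∷ s) (b ∷ r) (here , rest) zero    = here
separatedFrom⇒separated b₀ (a ∷ s) (b ∷ r) (here , rest) (suc j) = separatedFrom⇒separated a s r rest j

letterUV-letter : ∀ a b → (b ≡ true → a ≡ false) → letterUV a b ≡ just (letter a b)
letterUV-letter true  true  excl with excl refl
... | ()
letterUV-letter true  false excl = refl
letterUV-letter false true  excl = refl
letterUV-letter false false excl = refl

wordTail-shift : ∀ {n} b₀ a (s : Vec Bool n) b r (js : List (Fin n)) →
                 wordTail (b₀ ∷ a ∷ s) (b ∷ r) (map suc js) ≡ wordTail (a ∷ s) r js
wordTail-shift b₀ a s b r []       = refl
wordTail-shift b₀ a s b r (j ∷ js) = cong (consM _) (wordTail-shift b₀ a s b r js)

wordTail-letters : ∀ {n} p (s r : Vec Bool n) → SeparatedFrom p s r → wordTail (p ∷ s) r (allFin n) ≡ just (letters s r)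
wordTail-letters p []            []      _            = refl
wordTail-letters {suc n} p (a ∷ s) (b ∷ r) (here , rest) = begin
  wordTail (p ∷ a ∷ s) (b ∷ r) (allFin (suc n))
    ≡⟨ cong (wordTail (p ∷ a ∷ s) (b ∷ r)) (allFin-suc n) ⟩
  consM (letterUV a b) (wordTail (p ∷ a ∷ s) (b ∷ r) (map suc (allFin n)))
    ≡⟨ cong₂ consM (letterUV-letter a b (λ b≡ → proj₁ (here b≡)))
                   (trans (wordTail-shift p a s b r (allFin n)) (wordTail-letters a s r rest)) ⟩
  just (letters (a ∷ s) (b ∷ r)) ∎
  where open ≡-Reasoning

word-separated : ∀ n b₀ (s r : Vec Bool n) → SeparatedFrom b₀ s r → word n (b₀ ∷ s) r ≡ just (wordOf b₀ s r)
word-separated n b₀ s r sep = cong (consM (just (letter0 b₀))) (wordTail-letters b₀ s r sep)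

NoLeadingV : List Letter → Set
NoLeadingV (V ∷ _) = ⊥
NoLeadingV _       = ⊤

data UVFree : List Letter → Set where
  []  : UVFree []
  O∷  : ∀ {w} → UVFree w → UVFree (O ∷ w)
  V∷  : ∀ {w} → UVFree w → UVFree (V ∷ w)
  U∷  : ∀ {w} → NoLeadingV w → UVFree w → UVFree (U ∷ w)

letters-noLeadingV : ∀ {n} p (s r : Vec Bool n) → SeparatedFrom p s r → p ≡ true → NoLeadingV (letters s r)
letters-noLeadingV p []          []          _          _  = tt
letters-noLeadingV p (true  ∷ s) (b     ∷ r) _          _  = tt
letters-noLeadingV p (false ∷ s) (false ∷ r) _          _  = tt
letters-noLeadingV p (false ∷ s) (true  ∷ r) (here , _) p≡ with trans (sym p≡) (proj₂ (here refl))
... | ()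

letters-UVFree : ∀ {n} p (s r : Vec Bool n) → SeparatedFrom p s r → UVFree (letters s r)
letters-UVFree p []          []          _           = []
letters-UVFree p (true  ∷ s) (b     ∷ r) (_ , rest) = U∷ (letters-noLeadingV true s r rest refl) (letters-UVFree true s r rest)
letters-UVFree p (false ∷ s) (true  ∷ r) (_ , rest) = V∷ (letters-UVFree false s r rest)
letters-UVFree p (false ∷ s) (false ∷ r) (_ , rest) = O∷ (letters-UVFree false s r rest)

wordOf-UVFree : ∀ {n} b₀ (s r : Vec Bool n) → SeparatedFrom b₀ s r → UVFree (wordOf b₀ s r)
wordOf-UVFree true  s r sep = U∷ (letters-noLeadingV true s r sep refl) (letters-UVFree true s r sep)
wordOf-UVFree false s r sep = O∷ (letters-UVFree false s r sep)

wordOf-noLeadingV : ∀ {n} b₀ (s r : Vec Bool n) → NoLeadingV (wordOf b₀ s r)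
wordOf-noLeadingV true  s r = tt
wordOf-noLeadingV false s r = tt

blockWord : List (ℕ × ℕ) → ℕ → List Letter
blockWord []             c = replicate c U
blockWord ((a , b) ∷ bs) c = replicate a U ++ O ∷ replicate b V ++ blockWord bs c

blockSize : List (ℕ × ℕ) → ℕ
blockSize []             = 0
blockSize ((a , b) ∷ bs) = a + b + 1 + blockSize bs

length-blockWord : ∀ bs c → length (blockWord bs c) ≡ blockSize bs + c
length-blockWord []             c = length-replicate c
length-blockWord ((a , b) ∷ bs) c = begin
  length (replicate a U ++ O ∷ replicate b V ++ blockWord bs c)  ≡⟨ length-++ (replicate a U) ⟩
  length (replicate a U) + suc (length (replicate b V ++ blockWord bs c))
    ≡⟨ cong₂ (λ x y → x + suc y) (length-replicate a)
             (trans (length-++ (replicate b V)) (cong₂ _+_ (length-replicate b) (length-blockWord bs c))) ⟩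
  a + suc (b + (blockSize bs + c))                              ≡⟨ regroup a b (blockSize bs) c ⟩
  a + b + 1 + blockSize bs + c                                  ∎
  where
  open ≡-Reasoning
  regroup : ∀ a b s c → a + suc (b + (s + c)) ≡ a + b + 1 + s + c
  regroup = solve-∀

U∷blockWord : ∀ bs c → ∃[ bs′ ] ∃[ c′ ] U ∷ blockWord bs c ≡ blockWord bs′ c′
U∷blockWord []             c = [] , suc c , refl
U∷blockWord ((a , b) ∷ bs) c = (suc a , b) ∷ bs , c , refl

UVFree⇒blockWord : ∀ {w} → UVFree w → NoLeadingV w → ∃[ bs ] ∃[ c ] w ≡ blockWord bs c
UVFree⇒Vs++blockWord : ∀ {w} → UVFree w → ∃[ v ] ∃[ bs ] ∃[ c ] w ≡ replicate v V ++ blockWord bs c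

UVFree⇒blockWord []           _ = [] , 0 , refl
UVFree⇒blockWord (O∷ uv)      _ with UVFree⇒Vs++blockWord uv
... | v , bs , c , w≡ = (0 , v) ∷ bs , c , cong (O ∷_) w≡
UVFree⇒blockWord (U∷ nv uv)   _ with UVFree⇒blockWord uv nv
... | bs , c , w≡ with U∷blockWord bs c
...   | bs′ , c′ , U∷≡ = bs′ , c′ , trans (cong (U ∷_) w≡) U∷≡

UVFree⇒Vs++blockWord (V∷ uv) with UVFree⇒Vs++blockWord uv
... | v , bs , c , w≡ = suc v , bs , c , cong (V ∷_) w≡
UVFree⇒Vs++blockWord []         = 0 , UVFree⇒blockWord [] tt
UVFree⇒Vs++blockWord (O∷ uv)    = 0 , UVFree⇒blockWord (O∷ uv) tt
UVFree⇒Vs++blockWord (U∷ nv uv) = 0 , UVFree⇒blockWord (U∷ nv uv) tt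

pv-Us : ∀ c → pv (replicate c U) ≡ just (0 , [] , c)
pv-Us zero    = refl
pv-Us (suc c) rewrite pv-Us c = refl

pv-Vs++blockWord : ∀ v bs c → pv (replicate v V ++ blockWord bs c) ≡ just (v , bs , c)
pv-blockWord-cons : ∀ a b bs c → pv (blockWord ((a , b) ∷ bs) c) ≡ just (0 , (a , b) ∷ bs , c)
pv-Vs++blockWord (suc v) bs             c rewrite pv-Vs++blockWord v bs c = refl
pv-Vs++blockWord zero    []             c = pv-Us c
pv-Vs++blockWord zero    ((a , b) ∷ bs) c = pv-blockWord-cons a b bs c
pv-blockWord-cons zero    b bs c rewrite pv-Vs++blockWord b bs c = refl
pv-blockWord-cons (suc a) b bs c rewrite pv-blockWord-cons a b bs c = refl

parse-blockWord : ∀ bs c → parse (blockWord bs c) ≡ just (bs , c)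
parse-blockWord bs c rewrite pv-Vs++blockWord 0 bs c = refl

blockWord-UVFree : ∀ bs c → UVFree (blockWord bs c)
blockWord-UVFree []             zero    = []
blockWord-UVFree []             (suc c) = U∷ (noLeadingV c) (blockWord-UVFree [] c)
  where
  noLeadingV : ∀ c → NoLeadingV (replicate c U)
  noLeadingV zero    = tt
  noLeadingV (suc c) = tt
blockWord-UVFree ((a , b) ∷ bs) c = Us a
  where
  Vs : ∀ b → UVFree (replicate b V ++ blockWord bs c)
  Vs zero    = blockWord-UVFree bs c
  Vs (suc b) = V∷ (Vs b)
  Us : ∀ a → UVFree (replicate a U ++ O ∷ replicate b V ++ blockWord bs c)
  Us zero          = O∷ (Vs b)
  Us (suc zero)    = U∷ tt (Us zero)
  Us (suc (suc a)) = U∷ tt (Us (suc a))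

blockWord-noLeadingV : ∀ bs c → NoLeadingV (blockWord bs c)
blockWord-noLeadingV []                   zero    = tt
blockWord-noLeadingV []                   (suc c) = tt
blockWord-noLeadingV ((zero  , b) ∷ bs) c       = tt
blockWord-noLeadingV ((suc a , b) ∷ bs) c       = tt

isULetter isVLetter : Letter → Bool
isULetter U = true
isULetter _ = false
isVLetter V = true
isVLetter _ = false

UVFree-tail : ∀ {x w} → UVFree (x ∷ w) → UVFree w
UVFree-tail (O∷ uv)   = uv
UVFree-tail (V∷ uv)   = uv
UVFree-tail (U∷ _ uv) = uv

UVFree-after-U : ∀ {x w} → UVFree (x ∷ w) → isULetter x ≡ true → NoLeadingV w
UVFree-after-U (U∷ nv _) _ = nv

decode : (n : ℕ) → (Letter → Bool) → List Letter → Vec Bool n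
decode zero    f w       = []
decode (suc n) f []      = false ∷ decode n f []
decode (suc n) f (x ∷ w) = f x ∷ decode n f w

decode-letters : ∀ {n} p (s r : Vec Bool n) → SeparatedFrom p s r →
                 decode n isULetter (letters s r) ≡ s × decode n isVLetter (letters s r) ≡ r
decode-letters p []          []          _            = refl , refl
decode-letters p (true  ∷ s) (true  ∷ r) (here , _)   with proj₁ (here refl)
... | ()
decode-letters p (true  ∷ s) (false ∷ r) (_ , rest)   =
  let (s≡ , r≡) = decode-letters true s r rest in cong (true ∷_) s≡ , cong (false ∷_) r≡
decode-letters p (false ∷ s) (true  ∷ r) (_ , rest)   =
  let (s≡ , r≡) = decode-letters false s r rest in cong (false ∷_) s≡ , cong (true ∷_) r≡
decode-letters p (false ∷ s) (false ∷ r) (_ , rest)   =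
  let (s≡ , r≡) = decode-letters false s r rest in cong (false ∷_) s≡ , cong (false ∷_) r≡

letters-decode : ∀ n p (w : List Letter) → length w ≡ n → UVFree w → (p ≡ true → NoLeadingV w) →
                 SeparatedFrom p (decode n isULetter w) (decode n isVLetter w) ×
                 letters (decode n isULetter w) (decode n isVLetter w) ≡ w
letters-decode zero    p []      _    _  _  = tt , refl
letters-decode (suc n) p (x ∷ w) len uv nv =
  (here p x nv , proj₁ rest) , cong₂ _∷_ (letter-isULetter-isVLetter x) (proj₂ rest)
  where
  rest : SeparatedFrom (isULetter x) (decode n isULetter w) (decode n isVLetter w) ×
         letters (decode n isULetter w) (decode n isVLetter w) ≡ w
  rest = letters-decode n (isULetter x) w (suc-injective len) (UVFree-tail uv) (UVFree-after-U uv)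
  here : ∀ p x → (p ≡ true → NoLeadingV (x ∷ w)) → isVLetter x ≡ true → isULetter x ≡ false × p ≡ false
  here false V _  _ = refl , refl
  here true  V nv _ = contradiction (nv refl) λ ()
  letter-isULetter-isVLetter : ∀ x → letter (isULetter x) (isVLetter x) ≡ x
  letter-isULetter-isVLetter O = refl
  letter-isULetter-isVLetter U = refl
  letter-isULetter-isVLetter V = refl

wordOf-injective : ∀ {n} b₀ b₀′ (s r s′ r′ : Vec Bool n) → SeparatedFrom b₀ s r → SeparatedFrom b₀′ s′ r′ →
                   wordOf b₀ s r ≡ wordOf b₀′ s′ r′ → b₀ ≡ b₀′ × s ≡ s′ × r ≡ r′
wordOf-injective b₀ b₀′ s r s′ r′ sep sep′ w≡ =
  trans (sym (isULetter-letter0 b₀)) (trans (cong isULetter (proj₁ (∷-injective w≡))) (isULetter-letter0 b₀′)) ,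
  trans (sym (proj₁ (decode-letters b₀ s r sep)))
        (trans (cong (decode _ isULetter) tail≡) (proj₁ (decode-letters b₀′ s′ r′ sep′))) ,
  trans (sym (proj₂ (decode-letters b₀ s r sep)))
        (trans (cong (decode _ isVLetter) tail≡) (proj₂ (decode-letters b₀′ s′ r′ sep′)))
  where
  tail≡ : letters s r ≡ letters s′ r′
  tail≡ = proj₂ (∷-injective w≡)
  isULetter-letter0 : ∀ b → isULetter (letter0 b) ≡ b
  isULetter-letter0 true  = refl
  isULetter-letter0 false = refl

wordOf-surjective : ∀ n (w : List Letter) → length w ≡ suc n → UVFree w → NoLeadingV w →
                    ∃[ b₀ ] ∃[ s ] ∃[ r ] (SeparatedFrom b₀ s r × wordOf {n} b₀ s r ≡ w)
wordOf-surjective n (x ∷ w) len uv nv =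
  isULetter x , decode n isULetter w , decode n isVLetter w , proj₁ rest , cong₂ _∷_ (letter0-isULetter x nv) (proj₂ rest)
  where
  rest : SeparatedFrom (isULetter x) (decode n isULetter w) (decode n isVLetter w) ×
         letters (decode n isULetter w) (decode n isVLetter w) ≡ w
  rest = letters-decode n (isULetter x) w (suc-injective len) (UVFree-tail uv) (UVFree-after-U uv)
  letter0-isULetter : ∀ x → NoLeadingV (x ∷ w) → letter0 (isULetter x) ≡ x
  letter0-isULetter O _ = refl
  letter0-isULetter U _ = refl

-- Mountains

-- D and E count the up and down steps still available; the last mountain uses
-- what remains.
mountains : ℕ → ℕ → List (ℕ × ℕ) → List Step
mountains D E []             = mountain (D , E)
mountains D E ((a , b) ∷ bs) = mountain (a + b + 1 , a + 1) ++ mountains (D ∸ (a + b + 1)) (E ∸ (a + 1)) bs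

-- Stated for arbitrary F, G₁, G₂ so that it applies to the anonymous
-- functions inside pathOfBlocks.
concatMap-mountains : ∀ {F : ℕ × ℕ → List Step} {G₁ G₂ : ℕ × ℕ → ℕ} →
  (∀ a b → F (a , b) ≡ mountain (a + b + 1 , a + 1)) →
  (∀ a b → G₁ (a , b) ≡ a + b + 1) → (∀ a b → G₂ (a , b) ≡ a + 1) →
  ∀ D E bs → concatMap F bs ++ mountain (D ∸ sumN (map G₁ bs) , E ∸ sumN (map G₂ bs)) ≡ mountains D E bs
concatMap-mountains F≡ G₁≡ G₂≡ D E []             = refl
concatMap-mountains {F} {G₁} {G₂} F≡ G₁≡ G₂≡ D E ((a , b) ∷ bs) = begin
  (F (a , b) ++ concatMap F bs) ++ mountain (D ∸ (G₁ (a , b) + sumN (map G₁ bs)) , E ∸ (G₂ (a , b) + sumN (map G₂ bs)))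
    ≡⟨ ++-assoc (F (a , b)) (concatMap F bs) _ ⟩
  F (a , b) ++ concatMap F bs ++ mountain (D ∸ (G₁ (a , b) + sumN (map G₁ bs)) , E ∸ (G₂ (a , b) + sumN (map G₂ bs)))
    ≡⟨ cong₂ (λ x y → F (a , b) ++ concatMap F bs ++ mountain (x , y))
         (trans (cong (λ g → D ∸ (g + sumN (map G₁ bs))) (G₁≡ a b)) (sym (∸-+-assoc D (a + b + 1) _)))
         (trans (cong (λ g → E ∸ (g + sumN (map G₂ bs))) (G₂≡ a b)) (sym (∸-+-assoc E (a + 1) _))) ⟩
  F (a , b) ++ concatMap F bs ++ mountain (D ∸ (a + b + 1) ∸ sumN (map G₁ bs) , E ∸ (a + 1) ∸ sumN (map G₂ bs))
    ≡⟨ cong₂ _++_ (F≡ a b) (concatMap-mountains F≡ G₁≡ G₂≡ (D ∸ (a + b + 1)) (E ∸ (a + 1)) bs) ⟩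
  mountains D E ((a , b) ∷ bs) ∎
  where open ≡-Reasoning

pathOfBlocks-mountains : ∀ n bs → pathOfBlocks n bs ≡ mountains (n + 2) (n + 2) bs
pathOfBlocks-mountains n = concatMap-mountains (λ _ _ → refl) (λ _ _ → refl) (λ _ _ → refl) (n + 2) (n + 2)

mountains-cons : ∀ h a b {D} D′ bs → D ≡ (a + b + 1) + D′ →
  mountains D (h + D) ((a , b) ∷ bs) ≡ mountain (a + b + 1 , a + 1) ++ mountains D′ ((h + b) + D′) bs
mountains-cons h a b D′ bs refl = cong₂ (λ x y → mountain (a + b + 1 , a + 1) ++ mountains x y bs)
  (m+n∸m≡n (a + b + 1) D′)
  (trans (cong (_∸ (a + 1)) (regroup h a b D′)) (m+n∸m≡n (a + 1) ((h + b) + D′)))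
  where
  regroup : ∀ h a b d → h + ((a + b + 1) + d) ≡ (a + 1) + ((h + b) + d)
  regroup = solve-∀

budget-split : ∀ a b bs D → blockSize ((a , b) ∷ bs) < D → ∃[ D′ ] (D ≡ (a + b + 1) + D′ × blockSize bs < D′)
budget-split a b bs D fits = D ∸ (a + b + 1) , sym (m+[n∸m]≡n first≤) ,
  +-cancelˡ-< (a + b + 1) (blockSize bs) _ (subst (a + b + 1 + blockSize bs <_) (sym (m+[n∸m]≡n first≤)) fits)
  where
  first≤ : a + b + 1 ≤ D
  first≤ = ≤-trans (m≤m+n (a + b + 1) (blockSize bs)) (<⇒≤ fits)

ups-Dyck : ∀ d {h} X → DyckFrom (h + d) X → DyckFrom h (replicate d up ++ X)
ups-Dyck zero    {h} X dyck = subst (λ k → DyckFrom k X) (+-identityʳ h) dyck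
ups-Dyck (suc d) {h} X dyck = stepU (ups-Dyck d X (subst (λ k → DyckFrom k X) (+-suc h d) dyck))

downs-Dyck : ∀ e {h} X → DyckFrom h X → DyckFrom (e + h) (replicate e down ++ X)
downs-Dyck zero    X dyck = dyck
downs-Dyck (suc e) X dyck = stepD (downs-Dyck e X dyck)

downs-to-ground : ∀ e → DyckFrom e (replicate e down)
downs-to-ground zero    = done
downs-to-ground (suc e) = stepD (downs-to-ground e)

mountains-Dyck : ∀ bs h D → blockSize bs < D → DyckFrom h (mountains D (h + D) bs)
mountains-Dyck [] h D _ = ups-Dyck D (replicate (h + D) down) (downs-to-ground (h + D))
mountains-Dyck ((a , b) ∷ bs) h D fits with budget-split a b bs D fits
... | D′ , refl , fits′ rewrite mountains-cons h a b D′ bs refl =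
  subst (DyckFrom h) (sym (++-assoc (replicate (a + b + 1) up) (replicate (a + 1) down) _))
    (ups-Dyck (a + b + 1) _ (subst (λ k → DyckFrom k (replicate (a + 1) down ++ mountains D′ ((h + b) + D′) bs)) (regroup h a b)
      (downs-Dyck (a + 1) _ (mountains-Dyck bs (h + b) D′ fits′))))
  where
  regroup : ∀ h a b → (a + 1) + (h + b) ≡ h + (a + b + 1)
  regroup = solve-∀

length-mountains : ∀ bs h D → blockSize bs < D → length (mountains D (h + D) bs) ≡ D + (h + D)
length-mountains [] h D _ = trans (length-++ (replicate D up)) (cong₂ _+_ (length-replicate D) (length-replicate (h + D)))
length-mountains ((a , b) ∷ bs) h D fits with budget-split a b bs D fits
... | D′ , refl , fits′ rewrite mountains-cons h a b D′ bs refl = begin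
  length (mountain (a + b + 1 , a + 1) ++ mountains D′ ((h + b) + D′) bs)
    ≡⟨ length-++ (mountain (a + b + 1 , a + 1)) ⟩
  length (replicate (a + b + 1) up ++ replicate (a + 1) down) + length (mountains D′ ((h + b) + D′) bs)
    ≡⟨ cong₂ _+_ (trans (length-++ (replicate (a + b + 1) up))
                        (cong₂ _+_ (length-replicate (a + b + 1)) (length-replicate (a + 1))))
                 (length-mountains bs (h + b) D′ fits′) ⟩
  ((a + b + 1) + (a + 1)) + (D′ + ((h + b) + D′))
    ≡⟨ regroup h a b D′ ⟩
  (a + b + 1 + D′) + (h + (a + b + 1 + D′)) ∎
  where
  open ≡-Reasoning
  regroup : ∀ h a b d → ((a + b + 1) + (a + 1)) + (d + ((h + b) + d)) ≡ (a + b + 1 + d) + (h + (a + b + 1 + d))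
  regroup = solve-∀

valleys-ups : ∀ d h X → valleysFrom h (replicate d up ++ X) ≡ valleysFrom (h + d) X
valleys-ups zero    h X = cong (λ k → valleysFrom k X) (sym (+-identityʳ h))
valleys-ups (suc d) h X = trans (valleys-ups d (suc h) X) (cong (λ k → valleysFrom k X) (sym (+-suc h d)))

valleys-downs-up : ∀ e H Y →
  valleysFrom H (replicate (suc e) down ++ up ∷ Y) ≡ (H ∸ suc e) ∷ valleysFrom (H ∸ suc e) (up ∷ Y)
valleys-downs-up zero    H Y = refl
valleys-downs-up (suc e) H Y =
  trans (valleys-downs-up e (H ∸ 1) Y) (cong (λ k → k ∷ valleysFrom k (up ∷ Y)) (∸-+-assoc H 1 (suc e)))

valleys-downs : ∀ e H → valleysFrom H (replicate e down) ≡ []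
valleys-downs zero          H = refl
valleys-downs (suc zero)    H = refl
valleys-downs (suc (suc e)) H = valleys-downs (suc e) (H ∸ 1)

mountain-then-up : ∀ a b R → mountain (a + b + 1 , a + 1) ++ R ≡ replicate (a + b + 1) up ++ replicate (suc a) down ++ R
mountain-then-up a b R = trans (++-assoc (replicate (a + b + 1) up) (replicate (a + 1) down) R)
  (cong (λ k → replicate (a + b + 1) up ++ replicate k down ++ R) (+-comm a 1))

mountains-up : ∀ bs D E → blockSize bs < D → ∃[ Y ] mountains D E bs ≡ up ∷ Y
mountains-up []             (suc D) E _ = _ , refl
mountains-up ((a , b) ∷ bs) D       E _ rewrite +-comm (a + b) 1 = _ , refl

-- The valley after the mountain of (a , b) lies b above the previous one.
mountains-valleys : ∀ bs h D → blockSize bs < D → Linked _≤_ (h ∷ valleysFrom h (mountains D (h + D) bs))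
mountains-valleys [] h D _ rewrite valleys-ups D h (replicate (h + D) down) | valleys-downs (h + D) (h + D) = [-]
mountains-valleys ((a , b) ∷ bs) h D fits with budget-split a b bs D fits
... | D′ , refl , fits′ with mountains-up bs D′ ((h + b) + D′) fits′
...   | Y , R≡ rewrite mountains-cons h a b D′ bs refl =
  subst (λ vs → Linked _≤_ (h ∷ vs)) (sym valleys≡) (m≤m+n h b ∷ mountains-valleys bs (h + b) D′ fits′)
  where
  open ≡-Reasoning
  R : List Step
  R = mountains D′ ((h + b) + D′) bs
  descent : ∀ h a b → h + (a + b + 1) ∸ suc a ≡ h + b
  descent h a b = trans (cong (_∸ suc a) (regroup h a b)) (m+n∸m≡n (suc a) (h + b))
    where
    regroup : ∀ h a b → h + (a + b + 1) ≡ suc a + (h + b)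
    regroup = solve-∀
  valleys≡ : valleysFrom h (mountain (a + b + 1 , a + 1) ++ R) ≡ (h + b) ∷ valleysFrom (h + b) R
  valleys≡ = begin
    valleysFrom h (mountain (a + b + 1 , a + 1) ++ R)
      ≡⟨ cong (valleysFrom h) (trans (mountain-then-up a b R)
                                     (cong (λ X → replicate (a + b + 1) up ++ replicate (suc a) down ++ X) R≡)) ⟩
    valleysFrom h (replicate (a + b + 1) up ++ replicate (suc a) down ++ up ∷ Y)
      ≡⟨ valleys-ups (a + b + 1) h _ ⟩
    valleysFrom (h + (a + b + 1)) (replicate (suc a) down ++ up ∷ Y)
      ≡⟨ valleys-downs-up a (h + (a + b + 1)) Y ⟩
    (h + (a + b + 1) ∸ suc a) ∷ valleysFrom (h + (a + b + 1) ∸ suc a) (up ∷ Y)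
      ≡⟨ cong (λ k → k ∷ valleysFrom k (up ∷ Y)) (descent h a b) ⟩
    (h + b) ∷ valleysFrom (h + b) (up ∷ Y)
      ≡⟨ cong (λ X → (h + b) ∷ valleysFrom (h + b) X) (sym R≡) ⟩
    (h + b) ∷ valleysFrom (h + b) R ∎

pathOfBlocks-nondecreasing : ∀ n bs → blockSize bs < n + 2 → NondecDyck (n + 2) (pathOfBlocks n bs)
pathOfBlocks-nondecreasing n bs fits rewrite pathOfBlocks-mountains n bs =
  trans (length-mountains bs 0 (n + 2) fits) (sym (cong ((n + 2) +_) (+-identityʳ (n + 2)))) ,
  mountains-Dyck bs 0 (n + 2) fits ,
  Linked.tail (mountains-valleys bs 0 (n + 2) fits)

runs-injective : ∀ {x y : Step} → x ≢ y → ∀ m m′ X Y →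
                 replicate m x ++ y ∷ X ≡ replicate m′ x ++ y ∷ Y → m ≡ m′ × X ≡ Y
runs-injective x≢y zero    zero     X Y eq = refl , proj₂ (∷-injective eq)
runs-injective x≢y zero    (suc m′) X Y eq = contradiction (sym (proj₁ (∷-injective eq))) x≢y
runs-injective x≢y (suc m) zero     X Y eq = contradiction (proj₁ (∷-injective eq)) x≢y
runs-injective x≢y (suc m) (suc m′) X Y eq =
  let (m≡ , X≡) = runs-injective x≢y m m′ X Y (proj₂ (∷-injective eq)) in cong suc m≡ , X≡

longer-run : ∀ m {D} X Y → 0 < D → replicate (m + D) up ++ X ≢ replicate m up ++ down ∷ Y
longer-run zero    X Y (s≤s z≤n) ()
longer-run (suc m) X Y 0<D eq = longer-run m X Y 0<D (proj₂ (∷-injective eq))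

up≢down : up ≢ down
up≢down ()

mountains-injective : ∀ bs bs′ h D → blockSize bs < D → blockSize bs′ < D →
                      mountains D (h + D) bs ≡ mountains D (h + D) bs′ → bs ≡ bs′
mountains-injective []             []               h D _ _ _ = refl
mountains-injective []             ((a , b) ∷ bs′) h D _ fits′ eq with budget-split a b bs′ D fits′
... | D′ , refl , fits″ = contradiction (trans eq (trans (mountains-cons h a b D′ bs′ refl) (mountain-then-up a b _)))
                            (longer-run (a + b + 1) _ _ (≤-<-trans z≤n fits″))
mountains-injective ((a , b) ∷ bs) []               h D fits fits′ eq =
  sym (mountains-injective [] ((a , b) ∷ bs) h D fits′ fits (sym eq))
mountains-injective ((a , b) ∷ bs) ((a′ , b′) ∷ bs′) h D fits fits′ eq
  with budget-split a b bs D fits | budget-split a′ b′ bs′ D fits′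
... | D₁ , D≡₁ , fits₁ | D₂ , D≡₂ , fits₂
  with mountains-up bs D₁ ((h + b) + D₁) fits₁ | mountains-up bs′ D₂ ((h + b′) + D₂) fits₂
...   | Y₁ , R≡₁ | Y₂ , R≡₂ = finish fits₂ a≡ b≡ D₁≡ (trans R≡₁ (trans (cong (up ∷_) Y≡) (sym R≡₂)))
  where
  open ≡-Reasoning
  both : replicate (a + b + 1) up ++ down ∷ (replicate a down ++ up ∷ Y₁) ≡
         replicate (a′ + b′ + 1) up ++ down ∷ (replicate a′ down ++ up ∷ Y₂)
  both = begin
    replicate (a + b + 1) up ++ replicate (suc a) down ++ up ∷ Y₁
      ≡⟨ sym (mountain-then-up a b (up ∷ Y₁)) ⟩
    mountain (a + b + 1 , a + 1) ++ up ∷ Y₁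
      ≡⟨ cong (mountain (a + b + 1 , a + 1) ++_) (sym R≡₁) ⟩
    mountain (a + b + 1 , a + 1) ++ mountains D₁ ((h + b) + D₁) bs
      ≡⟨ sym (mountains-cons h a b D₁ bs D≡₁) ⟩
    mountains D (h + D) ((a , b) ∷ bs)
      ≡⟨ eq ⟩
    mountains D (h + D) ((a′ , b′) ∷ bs′)
      ≡⟨ mountains-cons h a′ b′ D₂ bs′ D≡₂ ⟩
    mountain (a′ + b′ + 1 , a′ + 1) ++ mountains D₂ ((h + b′) + D₂) bs′
      ≡⟨ cong (mountain (a′ + b′ + 1 , a′ + 1) ++_) R≡₂ ⟩
    mountain (a′ + b′ + 1 , a′ + 1) ++ up ∷ Y₂
      ≡⟨ mountain-then-up a′ b′ (up ∷ Y₂) ⟩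
    replicate (a′ + b′ + 1) up ++ replicate (suc a′) down ++ up ∷ Y₂ ∎
  ups : a + b + 1 ≡ a′ + b′ + 1 × replicate a down ++ up ∷ Y₁ ≡ replicate a′ down ++ up ∷ Y₂
  ups = runs-injective up≢down (a + b + 1) (a′ + b′ + 1) _ _ both
  downs : a ≡ a′ × Y₁ ≡ Y₂
  downs = runs-injective (≢-sym up≢down) a a′ Y₁ Y₂ (proj₂ ups)
  a≡ : a ≡ a′
  a≡ = proj₁ downs
  Y≡ : Y₁ ≡ Y₂
  Y≡ = proj₂ downs
  b≡ : b ≡ b′
  b≡ = +-cancelˡ-≡ a b b′ (trans (+-cancelʳ-≡ 1 (a + b) (a′ + b′) (proj₁ ups)) (cong (_+ b′) (sym a≡)))
  D₁≡ : D₁ ≡ D₂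
  D₁≡ = +-cancelˡ-≡ (a + b + 1) D₁ D₂ (trans (sym D≡₁) (trans D≡₂ (cong (_+ D₂) (sym (proj₁ ups)))))
  finish : ∀ {a′ b′ D₂ bs′} → blockSize bs′ < D₂ → a ≡ a′ → b ≡ b′ → D₁ ≡ D₂ →
           mountains D₁ ((h + b) + D₁) bs ≡ mountains D₂ ((h + b′) + D₂) bs′ → (a , b) ∷ bs ≡ (a′ , b′) ∷ bs′
  finish fits₂ refl refl refl R≡ = cong ((a , b) ∷_) (mountains-injective bs _ (h + b) D₁ fits₁ fits₂ R≡)

run-split : ∀ (x : Step) p → ∃[ k ] ∃[ q ] (p ≡ replicate k x ++ q × head q ≢ just x)
run-split up   []         = 0 , [] , refl , λ ()
run-split up   (down ∷ p) = 0 , down ∷ p , refl , λ ()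
run-split up   (up ∷ p)   with run-split up p
... | k , q , p≡ , q≢ = suc k , q , cong (up ∷_) p≡ , q≢
run-split down []         = 0 , [] , refl , λ ()
run-split down (up ∷ p)   = 0 , up ∷ p , refl , λ ()
run-split down (down ∷ p) with run-split down p
... | k , q , p≡ , q≢ = suc k , q , cong (down ∷_) p≡ , q≢

ups-inverse : ∀ k {h} q → DyckFrom h (replicate k up ++ q) → DyckFrom (h + k) q
ups-inverse zero    {h} q dyck         = subst (λ x → DyckFrom x q) (sym (+-identityʳ h)) dyck
ups-inverse (suc k) {h} q (stepU dyck) = subst (λ x → DyckFrom x q) (sym (+-suc h k)) (ups-inverse k q dyck)

downs-inverse : ∀ e {H} r → DyckFrom H (replicate e down ++ r) → ∃[ H′ ] (H ≡ e + H′ × DyckFrom H′ r)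
downs-inverse zero    r dyck         = _ , refl , dyck
downs-inverse (suc e) r (stepD dyck) with downs-inverse e r dyck
... | H′ , H≡ , dyck′ = H′ , cong suc H≡ , dyck′

Dyck-ground : ∀ {h} → DyckFrom h [] → h ≡ 0
Dyck-ground done = refl

record FirstMountain (h : ℕ) (p : List Step) : Set where
  field
    ascent descent valley : ℕ
    rest     : List Step
    shape    : p ≡ replicate (suc ascent) up ++ replicate (suc descent) down ++ rest
    altitude : h + suc ascent ≡ suc descent + valley
    rest-Dyck : DyckFrom valley rest
    rest-up  : rest ≡ [] ⊎ ∃[ r′ ] rest ≡ up ∷ r′

first-mountain : ∀ {h} p → DyckFrom h p → head p ≡ just up → FirstMountain h p
first-mountain {h} p dyck starts = ascend (run-split up p)
  where
  rest-up : ∀ r → head r ≢ just down → r ≡ [] ⊎ ∃[ r′ ] r ≡ up ∷ r′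
  rest-up []         _  = inj₁ refl
  rest-up (up ∷ r)   _  = inj₂ (r , refl)
  rest-up (down ∷ r) r≢ = contradiction refl r≢
  descend : ∀ k q → p ≡ replicate (suc k) up ++ q → DyckFrom (h + suc k) q → head q ≡ just down →
            ∃[ e ] ∃[ r ] (q ≡ replicate e down ++ r × head r ≢ just down) → FirstMountain h p
  descend k q p≡ dyck′ q-down (zero  , r , q≡ , r≢) = contradiction (subst (λ r → head r ≡ just down) q≡ q-down) r≢
  descend k q p≡ dyck′ q-down (suc e , r , q≡ , r≢) with downs-inverse (suc e) r (subst (DyckFrom (h + suc k)) q≡ dyck′)
  ... | H , H≡ , dyck″ = record
    { ascent = k ; descent = e ; valley = H ; rest = r
    ; shape = trans p≡ (cong (replicate (suc k) up ++_) q≡)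
    ; altitude = H≡ ; rest-Dyck = dyck″ ; rest-up = rest-up r r≢ }
  ascend : ∃[ k ] ∃[ q ] (p ≡ replicate k up ++ q × head q ≢ just up) → FirstMountain h p
  ascend (zero  , q , p≡ , q≢) = contradiction (subst (λ r → head r ≡ just up) p≡ starts) q≢
  ascend (suc k , q , p≡ , q≢) = descend k q p≡ dyck′ (down-next q dyck′ q≢) (run-split down q)
    where
    dyck′ : DyckFrom (h + suc k) q
    dyck′ = ups-inverse (suc k) q (subst (DyckFrom h) p≡ dyck)
    down-next : ∀ q → DyckFrom (h + suc k) q → head q ≢ just up → head q ≡ just down
    down-next []       dyck′ _  = contradiction (Dyck-ground dyck′) (subst (_≢ 0) (sym (+-suc h k)) λ ())
    down-next (up ∷ _) _     q≢ = contradiction refl q≢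
    down-next (down ∷ _) _   _  = refl

Decomposition : ℕ → List Step → Set
Decomposition h p = ∃[ D ] ∃[ bs ] (blockSize bs < D × mountains D (h + D) bs ≡ p)

module _ {h p} (fm : FirstMountain h p) where
  open FirstMountain fm

  first-valley : ∀ r′ → rest ≡ up ∷ r′ → valleysFrom h p ≡ valley ∷ valleysFrom valley rest
  first-valley r′ refl = begin
    valleysFrom h p
      ≡⟨ cong (valleysFrom h) shape ⟩
    valleysFrom h (replicate (suc ascent) up ++ replicate (suc descent) down ++ up ∷ r′)
      ≡⟨ valleys-ups (suc ascent) h _ ⟩
    valleysFrom (h + suc ascent) (replicate (suc descent) down ++ up ∷ r′)
      ≡⟨ valleys-downs-up descent (h + suc ascent) r′ ⟩
    (h + suc ascent ∸ suc descent) ∷ valleysFrom (h + suc ascent ∸ suc descent) (up ∷ r′)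
      ≡⟨ cong (λ x → x ∷ valleysFrom x (up ∷ r′))
              (trans (cong (_∸ suc descent) altitude) (m+n∸m≡n (suc descent) valley)) ⟩
    valley ∷ valleysFrom valley (up ∷ r′) ∎
    where open ≡-Reasoning

  first-block : h ≤ valley → suc ascent ≡ descent + (valley ∸ h) + 1
  first-block h≤ = +-cancelˡ-≡ h (suc ascent) _ (begin
    h + suc ascent                       ≡⟨ altitude ⟩
    suc descent + valley                 ≡⟨ cong (suc descent +_) (sym (m+[n∸m]≡n h≤)) ⟩
    suc descent + (h + (valley ∸ h))     ≡⟨ regroup h descent (valley ∸ h) ⟩
    h + (descent + (valley ∸ h) + 1)     ∎)
    where
    open ≡-Reasoning
    regroup : ∀ h e b → suc e + (h + b) ≡ h + (e + b + 1)
    regroup = solve-∀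

  length-rest : length rest < length p
  length-rest = subst (length rest <_) (sym (cong length shape))
    (s≤s (≤-trans (m≤n⇒m≤1+n (length-++-≤ʳ rest {replicate descent down}))
                  (length-++-≤ʳ (replicate (suc descent) down ++ rest) {replicate ascent up})))

  single-mountain : rest ≡ [] → Decomposition h p
  single-mountain rest≡ = suc ascent , [] , s≤s z≤n , (begin
    replicate (suc ascent) up ++ replicate (h + suc ascent) down
      ≡⟨ cong (λ x → replicate (suc ascent) up ++ replicate x down) (trans altitude (cong (suc descent +_) valley≡0)) ⟩
    replicate (suc ascent) up ++ replicate (suc descent + 0) down
      ≡⟨ cong (λ x → replicate (suc ascent) up ++ x)
              (trans (cong (λ x → replicate x down) (+-identityʳ _)) (sym (++-identityʳ _))) ⟩
    replicate (suc ascent) up ++ replicate (suc descent) down ++ []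
      ≡⟨ cong (λ r → replicate (suc ascent) up ++ replicate (suc descent) down ++ r) (sym rest≡) ⟩
    replicate (suc ascent) up ++ replicate (suc descent) down ++ rest
      ≡⟨ sym shape ⟩
    p ∎)
    where
    open ≡-Reasoning
    valley≡0 : valley ≡ 0
    valley≡0 = Dyck-ground (subst (DyckFrom valley) rest≡ rest-Dyck)

  prepend-mountain : h ≤ valley → Decomposition valley rest → Decomposition h p
  prepend-mountain h≤ (D′ , bs′ , fits′ , rest-mountains) =
    (descent + b + 1) + D′ , (descent , b) ∷ bs′ , +-monoʳ-< (descent + b + 1) fits′ , (begin
      mountains ((descent + b + 1) + D′) (h + ((descent + b + 1) + D′)) ((descent , b) ∷ bs′)
        ≡⟨ mountains-cons h descent b D′ bs′ refl ⟩
      mountain (descent + b + 1 , descent + 1) ++ mountains D′ ((h + b) + D′) bs′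
        ≡⟨ cong (λ x → mountain (descent + b + 1 , descent + 1) ++ mountains D′ (x + D′) bs′) (m+[n∸m]≡n h≤) ⟩
      mountain (descent + b + 1 , descent + 1) ++ mountains D′ (valley + D′) bs′
        ≡⟨ cong (mountain (descent + b + 1 , descent + 1) ++_) rest-mountains ⟩
      mountain (descent + b + 1 , descent + 1) ++ rest
        ≡⟨ ++-assoc (replicate (descent + b + 1) up) (replicate (descent + 1) down) rest ⟩
      replicate (descent + b + 1) up ++ replicate (descent + 1) down ++ rest
        ≡⟨ cong₂ (λ x y → replicate x up ++ replicate y down ++ rest) (sym (first-block h≤)) (+-comm descent 1) ⟩
      replicate (suc ascent) up ++ replicate (suc descent) down ++ rest
        ≡⟨ sym shape ⟩
      p ∎)
    where
    open ≡-Reasoning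
    b : ℕ
    b = valley ∸ h

decompose : ∀ m {h} p → length p ≤ m → DyckFrom h p → Linked _≤_ (h ∷ valleysFrom h p) → head p ≡ just up →
            Decomposition h p
decompose zero    (up ∷ _) () _ _ _
decompose (suc m) {h} p len dyck nondec starts = by-rest rest-up
  where
  fm : FirstMountain h p
  fm = first-mountain p dyck starts
  open FirstMountain fm
  by-rest : rest ≡ [] ⊎ ∃[ r′ ] rest ≡ up ∷ r′ → Decomposition h p
  by-rest (inj₁ rest≡)        = single-mountain fm rest≡
  by-rest (inj₂ (r′ , rest≡)) = prepend-mountain fm (Linked.head nondec′)
    (decompose m rest (≤-pred (≤-trans (length-rest fm) len)) rest-Dyck (Linked.tail nondec′) (cong head rest≡))
    where
    nondec′ : Linked _≤_ (h ∷ valley ∷ valleysFrom valley rest)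
    nondec′ = subst (λ vs → Linked _≤_ (h ∷ vs)) (first-valley fm r′ rest≡) nondec

nondecreasing⇒blocks : ∀ n p → NondecDyck (n + 2) p → ∃[ bs ] (blockSize bs < n + 2 × pathOfBlocks n bs ≡ p)
nondecreasing⇒blocks n []         (len , _ , _)  = contradiction (trans len (cong (2 *_) (+-comm n 2))) 0≢1+n
nondecreasing⇒blocks n (down ∷ _) (_ , () , _)
nondecreasing⇒blocks n (up ∷ p′) (len , dyck , nondec)
  with decompose (length (up ∷ p′)) (up ∷ p′) ≤-refl dyck (from-ground nondec) refl
  where
  from-ground : ∀ {vs} → Linked _≤_ vs → Linked _≤_ (0 ∷ vs)
  from-ground []      = [-]
  from-ground [-]     = z≤n ∷ [-]
  from-ground (r ∷ l) = z≤n ∷ r ∷ l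
... | D , bs , fits , path≡ = bs , subst (blockSize bs <_) D≡ fits ,
  trans (pathOfBlocks-mountains n bs) (subst (λ d → mountains d d bs ≡ up ∷ p′) D≡ path≡)
  where
  D≡ : D ≡ n + 2
  D≡ = *-cancelˡ-≡ D (n + 2) 2 (begin
    2 * D                          ≡⟨ cong (D +_) (+-identityʳ D) ⟩
    D + D                          ≡⟨ sym (length-mountains bs 0 D fits) ⟩
    length (mountains D D bs)      ≡⟨ cong length path≡ ⟩
    length (up ∷ p′)               ≡⟨ len ⟩
    2 * (n + 2)                    ∎)
    where open ≡-Reasoning

-- The bijection θ

θ-from-word : ∀ n S1 S2 {w bs c} → word n S1 S2 ≡ just w → parse w ≡ just (bs , c) →
              θ n S1 S2 ≡ just (pathOfBlocks n bs)
θ-from-word n S1 S2 {w} word≡ parse≡ with word n S1 S2 | word≡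
... | just .w | refl with parse w | parse≡
...   | just _ | refl = refl

length-letters : ∀ {n} (s r : Vec Bool n) → length (letters s r) ≡ n
length-letters []      []      = refl
length-letters (a ∷ s) (b ∷ r) = cong suc (length-letters s r)

θ-blockWord : ∀ n b₀ (s r : Vec Bool n) bs c → SeparatedFrom b₀ s r → wordOf b₀ s r ≡ blockWord bs c →
              θ n (b₀ ∷ s) r ≡ just (pathOfBlocks n bs)
θ-blockWord n b₀ s r bs c sep w≡ =
  θ-from-word n (b₀ ∷ s) r (word-separated n b₀ s r sep)
    (subst (λ w → parse w ≡ just (bs , c)) (sym w≡) (parse-blockWord bs c))

θ-separated : ∀ n b₀ (s r : Vec Bool n) → SeparatedFrom b₀ s r →
              ∃[ bs ] ∃[ c ] (blockSize bs + c ≡ suc n × wordOf b₀ s r ≡ blockWord bs c ×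
                              θ n (b₀ ∷ s) r ≡ just (pathOfBlocks n bs))
θ-separated n b₀ s r sep with UVFree⇒blockWord (wordOf-UVFree b₀ s r sep) (wordOf-noLeadingV b₀ s r)
... | bs , c , w≡ = bs , c , size , w≡ , θ-blockWord n b₀ s r bs c sep w≡
  where
  size : blockSize bs + c ≡ suc n
  size = trans (sym (length-blockWord bs c)) (trans (cong length (sym w≡)) (cong suc (length-letters s r)))

blockSize-< : ∀ n bs c → blockSize bs + c ≡ suc n → blockSize bs < n + 2
blockSize-< n bs c size = subst (blockSize bs <_) (+-comm 2 n) (s≤s (≤-trans (m≤m+n (blockSize bs) c) (≤-reflexive size)))

compatible⇒separatedFrom : ∀ n b₀ (s r : Vec Bool n) → Compatible n (b₀ ∷ s) r → SeparatedFrom b₀ s r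
compatible⇒separatedFrom n b₀ s r compat = separated⇒separatedFrom b₀ s r (compatible⇒separated n (b₀ ∷ s) r compat)

θ-compatible : ∀ n (S1 : Subset (suc n)) (S2 : Subset n) → Compatible n S1 S2 →
               ∃[ p ] (θ n S1 S2 ≡ just p × NondecDyck (n + 2) p)
θ-compatible n (b₀ ∷ s) r compat with θ-separated n b₀ s r (compatible⇒separatedFrom n b₀ s r compat)
... | bs , c , size , _ , θ≡ = pathOfBlocks n bs , θ≡ , pathOfBlocks-nondecreasing n bs (blockSize-< n bs c size)

θ-injective : ∀ n (S1 T1 : Subset (suc n)) (S2 T2 : Subset n) → Compatible n S1 S2 → Compatible n T1 T2 →
              θ n S1 S2 ≡ θ n T1 T2 → S1 ≡ T1 × S2 ≡ T2
θ-injective n (b₀ ∷ s) (b₀′ ∷ s′) r r′ compat compat′ θ≡θ′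
  with θ-separated n b₀ s r (compatible⇒separatedFrom n b₀ s r compat)
     | θ-separated n b₀′ s′ r′ (compatible⇒separatedFrom n b₀′ s′ r′ compat′)
... | bs , c , size , w≡ , θ≡ | bs′ , c′ , size′ , w≡′ , θ≡′ =
  cong₂ _∷_ (proj₁ words≡) (proj₁ (proj₂ words≡)) , proj₂ (proj₂ words≡)
  where
  bs≡ : bs ≡ bs′
  bs≡ = mountains-injective bs bs′ 0 (n + 2) (blockSize-< n bs c size) (blockSize-< n bs′ c′ size′)
          (trans (sym (pathOfBlocks-mountains n bs))
            (trans (just-injective (trans (sym θ≡) (trans θ≡θ′ θ≡′))) (pathOfBlocks-mountains n bs′)))
  c≡ : c ≡ c′
  c≡ = +-cancelˡ-≡ (blockSize bs) c c′ (trans size (trans (sym size′) (cong (λ b → blockSize b + c′) (sym bs≡))))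
  words≡ : b₀ ≡ b₀′ × s ≡ s′ × r ≡ r′
  words≡ = wordOf-injective b₀ b₀′ s r s′ r′
             (compatible⇒separatedFrom n b₀ s r compat) (compatible⇒separatedFrom n b₀′ s′ r′ compat′)
             (trans w≡ (trans (cong₂ blockWord bs≡ c≡) (sym w≡′)))

θ-surjective : ∀ n (p : List Step) → NondecDyck (n + 2) p →
               ∃[ S1 ] ∃[ S2 ] (Compatible n S1 S2 × θ n S1 S2 ≡ just p)
θ-surjective n p nondec with nondecreasing⇒blocks n p nondec
... | bs , bs-fits , path≡ with wordOf-surjective n (blockWord bs c) length≡ (blockWord-UVFree bs c) (blockWord-noLeadingV bs c)
  where
  c : ℕ
  c = suc n ∸ blockSize bs
  length≡ : length (blockWord bs c) ≡ suc n
  length≡ = trans (length-blockWord bs c) (m+[n∸m]≡n (≤-pred (subst (blockSize bs <_) (+-comm n 2) bs-fits)))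
...   | b₀ , s , r , sep , w≡ =
  b₀ ∷ s , r , separated⇒compatible n (b₀ ∷ s) r (separatedFrom⇒separated b₀ s r sep) ,
  trans (θ-blockWord n b₀ s r bs (suc n ∸ blockSize bs) sep w≡) (cong just path≡)

mainTheorem3 : (n : ℕ) →
    ((S1 : Subset (suc n)) (S2 : Subset n) → Compatible n S1 S2 →
      ∃[ p ] (θ n S1 S2 ≡ just p × NondecDyck (n + 2) p))
    × ((S1 T1 : Subset (suc n)) (S2 T2 : Subset n) →
      Compatible n S1 S2 → Compatible n T1 T2 →
      θ n S1 S2 ≡ θ n T1 T2 → S1 ≡ T1 × S2 ≡ T2)
    × ((p : List Step) → NondecDyck (n + 2) p →
      ∃[ S1 ] ∃[ S2 ] (Compatible n S1 S2 × θ n S1 S2 ≡ just p))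
mainTheorem3 n = θ-compatible n , θ-injective n , θ-surjective n
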